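{- Let $n\ge4$. If $w\in W(D_n)$ is bad, then $w$ is not fully commutative.
   Context: $W(D_n)$ is the Coxeter group with generators $s_1,\dots,s_n$, where $s_1s_3$, $s_2s_3$, $s_is_{i+1}$ ($3\le i\le n-1$) have order 3 and all other pairs of distinct generators commute. An element is bad if it is not a product of mutually commuting generators and no reduced expression of it begins or ends with two noncommuting generators. An element $w$ is fully commutative if there are no $w_1,w_2$ and generators $s,t$ with $m(s,t)=3$ with $w=w_1\,sts\,w_2$ and $\ell(w)=\ell(w_1)+3+\ell(w_2)$. -}

module Defs where

open import Data.Nat using (ℕ; zero; suc; _+_; _≤_)
open import Data.Fin using (Fin; toℕ)
open import Data.List using (List; []; _∷_; _++_; length)
open import Data.Product using (Σ; _×_; _,_; ∃)
open import Relation.Binary.PropositionalEquality using (_≡_; _≢_)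
open import Relation.Nullary using (¬_)
open import Data.List.Membership.Propositional using (_∈_)

-- Generators s₁,…,sₙ of W(Dₙ) are represented by Fin n; the generator
-- s_k corresponds to the index k-1 (so toℕ = k - 1).
-- Edges of the Coxeter graph of Dₙ (on 0-based indices):
--   s₁–s₃ : 0–2,  s₂–s₃ : 1–2,  s_i–s_{i+1} (3 ≤ i ≤ n-1) : (i-1)–i.
data EdgeN : ℕ → ℕ → Set where
  e13 : EdgeN 0 2
  e23 : EdgeN 1 2
  e-chain : ∀ i → EdgeN (suc (suc i)) (suc (suc (suc i)))

-- m(s,t) = 3 (symmetric closure of the edges)
data AdjN (i j : ℕ) : Set where
  fwd : EdgeN i j → AdjN i j
  bwd : EdgeN j i → AdjN i j

Adj : ∀ {n} → Fin n → Fin n → Set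
Adj s t = AdjN (toℕ s) (toℕ t)

Commute2 : ∀ {n} → Fin n → Fin n → Set
Commute2 s t = (s ≢ t) × ¬ Adj s t

Word : ℕ → Set
Word n = List (Fin n)

-- The congruence on words generated by the Coxeter relations of W(Dₙ);
-- elements of W(Dₙ) are words modulo _≈_.
data _≈_ {n : ℕ} : Word n → Word n → Set where
  ≈-refl  : ∀ {u} → u ≈ u
  ≈-sym   : ∀ {u v} → u ≈ v → v ≈ u
  ≈-trans : ∀ {u v w} → u ≈ v → v ≈ w → u ≈ w
  ≈-cong  : ∀ a b {u v} → u ≈ v → (a ++ u ++ b) ≈ (a ++ v ++ b)
  rel-sq  : ∀ s → (s ∷ s ∷ []) ≈ []
  rel-3   : ∀ s t → Adj s t → (s ∷ t ∷ s ∷ []) ≈ (t ∷ s ∷ t ∷ [])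
  rel-2   : ∀ s t → Commute2 s t → (s ∷ t ∷ []) ≈ (t ∷ s ∷ [])

infix 4 _≈_

HasLength : ∀ {n} → Word n → ℕ → Set
HasLength w k = (Σ (Word _) λ v → (v ≈ w) × (length v ≡ k))
              × (∀ v → v ≈ w → k ≤ length v)

Reduced : ∀ {n} → Word n → Set
Reduced v = ∀ u → u ≈ v → length v ≤ length u

data PairwiseCommuting {n : ℕ} : Word n → Set where
  pc-[] : PairwiseCommuting []
  pc-∷  : ∀ {s v} → (∀ {t} → t ∈ v → ¬ Adj s t)
        → PairwiseCommuting v → PairwiseCommuting (s ∷ v)

CommProduct : ∀ {n} → Word n → Set
CommProduct w = Σ (Word _) λ v → (v ≈ w) × PairwiseCommuting v

BeginsNC : ∀ {n} → Word n → Set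
BeginsNC v = Σ _ λ s → Σ _ λ t → Σ (Word _) λ r → (v ≡ s ∷ t ∷ r) × Adj s t

EndsNC : ∀ {n} → Word n → Set
EndsNC v = Σ _ λ s → Σ _ λ t → Σ (Word _) λ r → (v ≡ r ++ s ∷ t ∷ []) × Adj s t

Bad : ∀ {n} → Word n → Set
Bad w = ¬ CommProduct w
      × (∀ v → v ≈ w → Reduced v → ¬ BeginsNC v × ¬ EndsNC v)

FullyCommutative : ∀ {n} → Word n → Set
FullyCommutative {n} w =
  ¬ (Σ (Word n) λ w₁ → Σ (Word n) λ w₂ → Σ (Fin n) λ s → Σ (Fin n) λ t →
     Σ ℕ λ l → Σ ℕ λ l₁ → Σ ℕ λ l₂ →
       Adj s t × (w ≈ w₁ ++ s ∷ t ∷ s ∷ w₂)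
       × HasLength w l × HasLength w₁ l₁ × HasLength w₂ l₂
       × (l ≡ l₁ + 3 + l₂))

-- Read a reduced expression v of w as the sequence of labels of its letters. Reducedness and full
-- commutativity say that between two consecutive occurrences of a generator there are two occurrences
-- of its neighbours; badness says that no noncommuting pair of letters can be moved to the front or to
-- the back of v. It suffices to show that then no two letters of v are joined by an edge, for then v is
-- a product of commuting generators.
--
-- Root the graph of Dₙ at s₁ and call a position of v a top if it is maximal but not minimal in the
-- heap of v. An edge between two letters yields a top, and from every top s there is a top whose label
-- has higher rank: if a child of the label of s occurs below s one climbs the heap inside the subtree of
-- that child, and otherwise a case analysis of the parent and its other neighbours, pushed along the chain
-- s₃ – s₄ – … – sₙ, either contradicts the three conditions or climbs into {s₄, …, sₙ}. As ranks are
-- less than n, this is impossible.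

module Submission where

open import Defs

open import Data.Empty using (⊥; ⊥-elim)
open import Data.Fin using (Fin; toℕ)
open import Data.Fin.Properties using (toℕ<n; toℕ-injective)
open import Data.List using ([]; _∷_; _++_; length)
open import Data.List.Membership.Propositional using (_∈_)
open import Data.List.Membership.Propositional.Properties using (∈-++⁻)
open import Data.List.Properties using (length-++; ++-assoc; ++-identityʳ)
open import Data.List.Relation.Unary.Any using (here; there)
open import Data.Nat using (ℕ; zero; suc; _+_; _≤_; _<_; z≤n; s≤s; _≟_; _<?_; _≤?_)
open import Data.Nat.Induction using (<-rec)
open import Data.Nat.Properties
open import Data.Nat.Tactic.RingSolver using (solve-∀)
open import Data.Product using (Σ; ∃; _×_; _,_; _,′_; proj₁; proj₂)
open import Data.Sum using (_⊎_; inj₁; inj₂)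
open import Data.Unit using (tt)
open import Function using (case_of_)
open import Relation.Binary using (tri<; tri≈; tri>)
open import Relation.Binary.PropositionalEquality
open import Relation.Nullary using (¬_; Dec; yes; no)
open import Relation.Nullary.Decidable using (_×-dec_; ¬?)
open import Relation.Unary using (Decidable)

-- The Coxeter graph of Dₙ

edge? : ∀ a b → Dec (EdgeN a b)
edge? zero (suc (suc zero)) = yes e13
edge? (suc zero) (suc (suc zero)) = yes e23
edge? (suc (suc a)) (suc (suc (suc b))) with a ≟ b
... | yes refl = yes (e-chain a)
... | no a≢b = no λ { (e-chain _) → a≢b refl }
edge? zero zero = no λ ()
edge? zero (suc zero) = no λ ()
edge? zero (suc (suc (suc b))) = no λ ()
edge? (suc zero) zero = no λ ()
edge? (suc zero) (suc zero) = no λ ()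
edge? (suc zero) (suc (suc (suc b))) = no λ ()
edge? (suc (suc a)) zero = no λ ()
edge? (suc (suc a)) (suc zero) = no λ ()
edge? (suc (suc a)) (suc (suc zero)) = no λ ()

adj? : ∀ a b → Dec (AdjN a b)
adj? a b with edge? a b | edge? b a
... | yes e | _ = yes (fwd e)
... | no _ | yes e = yes (bwd e)
... | no ¬ab | no ¬ba = no λ { (fwd e) → ¬ab e ; (bwd e) → ¬ba e }

adj-sym : ∀ {a b} → AdjN a b → AdjN b a
adj-sym (fwd e) = bwd e
adj-sym (bwd e) = fwd e

adj-from-0 : ∀ {x} → AdjN 0 x → x ≡ 2
adj-from-0 (fwd e13) = refl

adj-from-1 : ∀ {x} → AdjN 1 x → x ≡ 2
adj-from-1 (fwd e23) = refl

adj-from-2 : ∀ {x} → AdjN 2 x → x ≡ 0 ⊎ x ≡ 1 ⊎ x ≡ 3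
adj-from-2 (fwd (e-chain .0)) = inj₂ (inj₂ refl)
adj-from-2 (bwd e13) = inj₁ refl
adj-from-2 (bwd e23) = inj₂ (inj₁ refl)

adj-from-3+ : ∀ k {x} → AdjN (3 + k) x → x ≡ 2 + k ⊎ x ≡ 4 + k
adj-from-3+ k (fwd (e-chain .(suc k))) = inj₂ refl
adj-from-3+ k (bwd (e-chain .k)) = inj₁ refl

adj-chain : ∀ j → AdjN (2 + j) (3 + j)
adj-chain j = fwd (e-chain j)

-- Labels 0 and 1, i.e. s₁ and s₂: the two leaves at the fork s₃.
Leaf : ℕ → Set
Leaf ℓ = ℓ ≡ 0 ⊎ ℓ ≡ 1

leaf-adj : ∀ {ℓ x} → Leaf ℓ → AdjN ℓ x → x ≡ 2
leaf-adj (inj₁ refl) = adj-from-0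
leaf-adj (inj₂ refl) = adj-from-1

leaf-adj-2 : ∀ {ℓ} → Leaf ℓ → AdjN ℓ 2
leaf-adj-2 (inj₁ refl) = fwd e13
leaf-adj-2 (inj₂ refl) = fwd e23

adj-from-2-leaf : ∀ {x} → AdjN 2 x → Leaf x ⊎ x ≡ 3
adj-from-2-leaf a with adj-from-2 a
... | inj₁ e = inj₁ (inj₁ e)
... | inj₂ (inj₁ e) = inj₁ (inj₂ e)
... | inj₂ (inj₂ e) = inj₂ e

leaf-third : ∀ {a b c} → Leaf a → Leaf b → Leaf c → a ≢ b → c ≢ b → c ≡ a
leaf-third (inj₁ refl) _ (inj₁ refl) _ _ = refl
leaf-third (inj₂ refl) _ (inj₂ refl) _ _ = refl
leaf-third (inj₁ refl) (inj₁ refl) _ a≢b _ = ⊥-elim (a≢b refl)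
leaf-third (inj₂ refl) (inj₂ refl) _ a≢b _ = ⊥-elim (a≢b refl)
leaf-third (inj₁ refl) (inj₂ refl) (inj₂ refl) _ c≢b = ⊥-elim (c≢b refl)
leaf-third (inj₂ refl) (inj₁ refl) (inj₁ refl) _ c≢b = ⊥-elim (c≢b refl)

Conflict : ℕ → ℕ → Set
Conflict a b = a ≡ b ⊎ AdjN a b

Commute : ℕ → ℕ → Set
Commute a b = ¬ Conflict a b

conflict? : ∀ a b → Dec (Conflict a b)
conflict? a b with a ≟ b | adj? a b
... | yes a≡b | _ = yes (inj₁ a≡b)
... | no _ | yes ab = yes (inj₂ ab)
... | no a≢b | no ¬ab = no λ { (inj₁ a≡b) → a≢b a≡b ; (inj₂ ab) → ¬ab ab }

conflict-sym : ∀ {a b} → Conflict a b → Conflict b a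
conflict-sym (inj₁ e) = inj₁ (sym e)
conflict-sym (inj₂ ab) = inj₂ (adj-sym ab)

module _ {P : ℕ → Set} (P? : Decidable P) where

  greatest-below : ∀ b p → p < b → P p →
    Σ ℕ λ q → p ≤ q × q < b × P q × (∀ r → q < r → r < b → ¬ P r)
  greatest-below (suc b) p p<1+b Pp with P? b
  ... | yes Pb = b , ≤-pred p<1+b , ≤-refl , Pb , λ r b<r r<1+b → ⊥-elim (<⇒≱ b<r (≤-pred r<1+b))
  ... | no ¬Pb with p ≟ b
  ... | yes refl = ⊥-elim (¬Pb Pp)
  ... | no p≢b with greatest-below b p (≤∧≢⇒< (≤-pred p<1+b) p≢b) Pp
  ... | q , p≤q , q<b , Pq , after = q , p≤q , m<n⇒m<1+n q<b , Pq , after′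
    where
    after′ : ∀ r → q < r → r < suc b → ¬ P r
    after′ r q<r r<1+b with r ≟ b
    ... | yes refl = ¬Pb
    ... | no r≢b = after r q<r (≤∧≢⇒< (≤-pred r<1+b) r≢b)

  LeastWitness : ℕ → Set
  LeastWitness p = P p → Σ ℕ λ q → q ≤ p × P q × (∀ r → r < q → ¬ P r)

  least-below : ∀ p → LeastWitness p
  least-below = <-rec LeastWitness go
    where
    go : ∀ p → (∀ {r} → r < p → LeastWitness r) → LeastWitness p
    go p rec Pp with anyUpTo? P? p
    ... | no none = p , ≤-refl , Pp , λ r r<p Pr → none (r , r<p , Pr)
    ... | yes (r , r<p , Pr) with rec r<p Pr
    ... | q , q≤r , Pq , before = q , ≤-trans q≤r (<⇒≤ r<p) , Pq , before

least-above : ∀ {P : ℕ → Set} → Decidable P → ∀ a p → a < p → P p →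
  Σ ℕ λ q → a < q × q ≤ p × P q × (∀ r → a < r → r < q → ¬ P r)
least-above P? a p a<p Pp with least-below (λ r → (a <? r) ×-dec P? r) p (a<p , Pp)
... | q , q≤p , (a<q , Pq) , before = q , a<q , q≤p , Pq , λ r a<r r<q Pr → before r r<q (a<r , Pr)

-- Dₙ as a tree rooted at s₁; the rank lists s₁, s₃, s₂, s₄, …, sₙ and increases from parent to child.

rank : ℕ → ℕ
rank 0 = 0
rank 1 = 2
rank 2 = 1
rank (suc (suc (suc k))) = 3 + k

Child : ℕ → ℕ → Set
Child 0 x = x ≡ 2
Child 1 x = ⊥
Child 2 x = x ≡ 1 ⊎ x ≡ 3
Child (suc (suc (suc k))) x = x ≡ 4 + k

child? : ∀ e x → Dec (Child e x)
child? 0 x = x ≟ 2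
child? 1 x = no λ ()
child? 2 x with x ≟ 1 | x ≟ 3
... | yes x≡1 | _ = yes (inj₁ x≡1)
... | no _ | yes x≡3 = yes (inj₂ x≡3)
... | no x≢1 | no x≢3 = no λ { (inj₁ x≡1) → x≢1 x≡1 ; (inj₂ x≡3) → x≢3 x≡3 }
child? (suc (suc (suc k))) x = x ≟ 4 + k

Parent : ℕ → ℕ → Set
Parent 0 x = ⊥
Parent 1 x = x ≡ 2
Parent 2 x = x ≡ 0
Parent 3 x = x ≡ 2
Parent (suc (suc (suc (suc k)))) x = x ≡ 3 + k

child⇒adj : ∀ e g → Child e g → AdjN g e
child⇒adj 0 .2 refl = bwd e13
child⇒adj 2 .1 (inj₁ refl) = fwd e23
child⇒adj 2 .3 (inj₂ refl) = bwd (e-chain 0)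
child⇒adj (suc (suc (suc k))) .(4 + k) refl = bwd (e-chain (suc k))

parent⇒adj : ∀ e c → Parent e c → AdjN c e
parent⇒adj 1 .2 refl = bwd e23
parent⇒adj 2 .0 refl = fwd e13
parent⇒adj 3 .2 refl = fwd (e-chain 0)
parent⇒adj (suc (suc (suc (suc k)))) .(3 + k) refl = fwd (e-chain (suc k))

adj⇒child⊎parent : ∀ e x → AdjN x e → Child e x ⊎ Parent e x
adj⇒child⊎parent 0 x a = inj₁ (adj-from-0 (adj-sym a))
adj⇒child⊎parent 1 x a = inj₂ (adj-from-1 (adj-sym a))
adj⇒child⊎parent 2 x a with adj-from-2 (adj-sym a)
... | inj₁ e = inj₂ e
... | inj₂ (inj₁ e) = inj₁ (inj₁ e)
... | inj₂ (inj₂ e) = inj₁ (inj₂ e)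
adj⇒child⊎parent 3 x a with adj-from-3+ 0 (adj-sym a)
... | inj₁ e = inj₂ e
... | inj₂ e = inj₁ e
adj⇒child⊎parent (suc (suc (suc (suc k)))) x a with adj-from-3+ (suc k) (adj-sym a)
... | inj₁ e = inj₂ e
... | inj₂ e = inj₁ e

child-irrefl : ∀ e x → Child e x → x ≢ e
child-irrefl 0 .2 refl ()
child-irrefl 2 .1 (inj₁ refl) ()
child-irrefl 2 .3 (inj₂ refl) ()
child-irrefl (suc (suc (suc k))) .(4 + k) refl ()

parent-irrefl : ∀ e x → Parent e x → x ≢ e
parent-irrefl 1 .2 refl ()
parent-irrefl 2 .0 refl ()
parent-irrefl 3 .2 refl ()
parent-irrefl (suc (suc (suc (suc k)))) .(3 + k) refl ()

parent-unique : ∀ e a b → Parent e a → Parent e b → a ≡ b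
parent-unique 1 .2 .2 refl refl = refl
parent-unique 2 .0 .0 refl refl = refl
parent-unique 3 .2 .2 refl refl = refl
parent-unique (suc (suc (suc (suc k)))) _ _ refl refl = refl

-- The proper descendants of g (only needed when g is a child, so never for g = s₁).
Below : ℕ → ℕ → Set
Below 0 x = ⊥
Below 1 x = ⊥
Below 2 x = x ≢ 0 × x ≢ 2
Below (suc (suc (suc k))) x = 4 + k ≤ x

below? : ∀ g → Decidable (Below g)
below? 0 x = no λ ()
below? 1 x = no λ ()
below? 2 x = ¬? (x ≟ 0) ×-dec ¬? (x ≟ 2)
below? (suc (suc (suc k))) x = 4 + k ≤? x

adj-from-≥3 : ∀ a x → 3 ≤ a → AdjN a x → suc x ≡ a ⊎ x ≡ suc a
adj-from-≥3 1 x (s≤s ()) a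
adj-from-≥3 2 x (s≤s (s≤s ())) a
adj-from-≥3 (suc (suc (suc k))) x _ a with adj-from-3+ k a
... | inj₁ e = inj₁ (cong suc e)
... | inj₂ e = inj₂ e

grandchild-below : ∀ e g x → Child e g → AdjN x g → x ≢ e → Below g x
grandchild-below 0 .2 x refl a x≢0 with adj-from-2 (adj-sym a)
... | inj₁ refl = ⊥-elim (x≢0 refl)
... | inj₂ (inj₁ refl) = (λ ()) , (λ ())
... | inj₂ (inj₂ refl) = (λ ()) , (λ ())
grandchild-below 2 .1 x (inj₁ refl) a x≢2 = ⊥-elim (x≢2 (adj-from-1 (adj-sym a)))
grandchild-below 2 .3 x (inj₂ refl) a x≢2 with adj-from-3+ 0 (adj-sym a)
... | inj₁ e = ⊥-elim (x≢2 e)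
... | inj₂ e = ≤-reflexive (sym e)
grandchild-below (suc (suc (suc k))) .(4 + k) x refl a x≢e with adj-from-3+ (suc k) (adj-sym a)
... | inj₁ e = ⊥-elim (x≢e e)
... | inj₂ e = ≤-reflexive (sym e)

below-conflict-closed : ∀ g a x → Below g a → Conflict x a → Below g x ⊎ x ≡ g
below-conflict-closed g a x below (inj₁ refl) = inj₁ below
below-conflict-closed 2 0 x (a≢0 , _) (inj₂ _) = ⊥-elim (a≢0 refl)
below-conflict-closed 2 1 x _ (inj₂ xa) = inj₂ (adj-from-1 (adj-sym xa))
below-conflict-closed 2 2 x (_ , a≢2) (inj₂ _) = ⊥-elim (a≢2 refl)
below-conflict-closed 2 (suc (suc (suc k))) x _ (inj₂ xa) with adj-from-3+ k (adj-sym xa)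
below-conflict-closed 2 (suc (suc (suc zero))) x _ (inj₂ xa) | inj₁ e = inj₂ e
below-conflict-closed 2 (suc (suc (suc (suc k)))) x _ (inj₂ xa) | inj₁ refl = inj₁ ((λ ()) , (λ ()))
below-conflict-closed 2 (suc (suc (suc k))) x _ (inj₂ xa) | inj₂ refl = inj₁ ((λ ()) , (λ ()))
below-conflict-closed (suc (suc (suc k))) a x below (inj₂ xa)
  with adj-from-≥3 a x (≤-trans (s≤s (s≤s (s≤s z≤n))) below) (adj-sym xa)
... | inj₂ e = inj₁ (≤-trans below (≤-trans (n≤1+n a) (≤-reflexive (sym e))))
... | inj₁ e with 4 + k ≟ a
... | yes refl = inj₂ (suc-injective e)
... | no ne = inj₁ (≤-pred (≤-trans (≤∧≢⇒< below ne) (≤-reflexive (sym e))))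

≥3-conflict-closed : ∀ a x → 3 ≤ a → Conflict x a → 3 ≤ x ⊎ x ≡ 2
≥3-conflict-closed a x 3≤a (inj₁ refl) = inj₁ 3≤a
≥3-conflict-closed a x 3≤a (inj₂ xa) with adj-from-≥3 a x 3≤a (adj-sym xa)
... | inj₂ e = inj₁ (≤-trans 3≤a (≤-trans (n≤1+n a) (≤-reflexive (sym e))))
... | inj₁ e with x ≟ 2
... | yes x≡2 = inj₂ x≡2
... | no x≢2 = inj₁ (≤∧≢⇒< (≤-pred (≤-trans 3≤a (≤-reflexive (sym e)))) (λ 2≡x → x≢2 (sym 2≡x)))

rank-≥3 : ∀ x → 3 ≤ x → rank x ≡ x
rank-≥3 1 (s≤s ())
rank-≥3 2 (s≤s (s≤s ()))
rank-≥3 (suc (suc (suc k))) _ = refl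

rank-below : ∀ e g x → Child e g → Below g x → rank e < rank x
rank-below 0 .2 0 refl (x≢0 , _) = ⊥-elim (x≢0 refl)
rank-below 0 .2 1 refl _ = s≤s z≤n
rank-below 0 .2 2 refl (_ , x≢2) = ⊥-elim (x≢2 refl)
rank-below 0 .2 (suc (suc (suc x))) refl _ = s≤s z≤n
rank-below 2 .1 x (inj₁ refl) ()
rank-below 2 .3 x (inj₂ refl) below
  rewrite rank-≥3 x (≤-trans (s≤s (s≤s (s≤s z≤n))) below) = ≤-trans (s≤s (s≤s z≤n)) below
rank-below (suc (suc (suc k))) .(4 + k) x refl below
  rewrite rank-≥3 x (≤-trans (s≤s (s≤s (s≤s z≤n))) below) = ≤-trans (n≤1+n _) below

rank< : ∀ n x → 3 ≤ n → x < n → rank x < n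
rank< n 0 3≤n _ = ≤-trans (s≤s z≤n) 3≤n
rank< n 1 3≤n _ = 3≤n
rank< n 2 3≤n _ = ≤-trans (s≤s (s≤s z≤n)) 3≤n
rank< n (suc (suc (suc k))) _ x<n = x<n

Absent : (ℕ → ℕ) → ℕ → ℕ → ℕ → Set
Absent f ℓ i k = ∀ p → i < p → p < k → f p ≢ ℓ

AbsentBefore : (ℕ → ℕ) → ℕ → ℕ → Set
AbsentBefore f ℓ k = ∀ p → p < k → f p ≢ ℓ

OnlyAt : (ℕ → ℕ) → ℕ → ℕ → ℕ → ℕ → Set
OnlyAt f ℓ i k z = ∀ p → i < p → p < k → f p ≡ ℓ → p ≡ z

NoTwoNeighbours : (ℕ → ℕ) → ℕ → ℕ → ℕ → Set
NoTwoNeighbours f ℓ i k =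
  ∀ p₁ p₂ → i < p₁ → p₁ < p₂ → p₂ < k → AdjN ℓ (f p₁) → AdjN ℓ (f p₂) → ⊥

module _ {f : ℕ → ℕ} {ℓ : ℕ} where

  only-at : ∀ {i k z} → Absent f ℓ i z → Absent f ℓ z k → OnlyAt f ℓ i k z
  only-at {z = z} before after p i<p p<k fp with <-cmp p z
  ... | tri< p<z _ _ = ⊥-elim (before p i<p p<z fp)
  ... | tri≈ _ p≡z _ = p≡z
  ... | tri> _ _ z<p = ⊥-elim (after p z<p p<k fp)

  absent-across : ∀ {i k z} → Absent f ℓ i z → f z ≢ ℓ → Absent f ℓ z k → Absent f ℓ i k
  absent-across before fz≢ℓ after p i<p p<k fp with only-at before after p i<p p<k fp
  ... | refl = fz≢ℓ fp

  absent-before⇒absent : ∀ {i k} → AbsentBefore f ℓ k → Absent f ℓ i k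
  absent-before⇒absent absent p _ p<k = absent p p<k

  ¬occurs⇒absent-before : ∀ {k} → ¬ (∃ λ p → p < k × f p ≡ ℓ) → AbsentBefore f ℓ k
  ¬occurs⇒absent-before none p p<k fp = none (p , p<k , fp)

  absent-within : ∀ {i k i′ k′} → Absent f ℓ i k → i ≤ i′ → k′ ≤ k → Absent f ℓ i′ k′
  absent-within absent i≤i′ k′≤k p i′<p p<k′ = absent p (≤-<-trans i≤i′ i′<p) (<-≤-trans p<k′ k′≤k)

  only-at-twice : ∀ {i k z p₁ p₂} → OnlyAt f ℓ i k z → i < p₁ → p₁ < p₂ → p₂ < k →
                  f p₁ ≡ ℓ → f p₂ ≡ ℓ → ⊥
  only-at-twice only i<p₁ p₁<p₂ p₂<k fp₁ fp₂ =
    <-irrefl (trans (only _ i<p₁ (<-trans p₁<p₂ p₂<k) fp₁) (sym (only _ (<-trans i<p₁ p₁<p₂) p₂<k fp₂))) p₁<p₂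

-- What the labels f p of a reduced expression of length L of a bad fully commutative element satisfy.
record HeapConditions (L : ℕ) (f : ℕ → ℕ) : Set where
  field
    two-neighbours-between : ∀ ℓ i k → i < k → k < L → f i ≡ ℓ → f k ≡ ℓ → Absent f ℓ i k →
                             ¬ NoTwoNeighbours f ℓ i k
    no-noncommuting-prefix : ∀ i j → i < j → j < L → AdjN (f i) (f j) →
                             (∀ p → p < i → Commute (f p) (f i)) →
                             (∀ p → p < j → p ≢ i → Commute (f p) (f j)) → ⊥
    no-noncommuting-suffix : ∀ i j → i < j → j < L → AdjN (f i) (f j) →
                             (∀ p → j < p → p < L → Commute (f p) (f j)) →
                             (∀ p → i < p → p < L → p ≢ j → Commute (f p) (f i)) → ⊥

module HeapCore {L : ℕ} {f : ℕ → ℕ} (hc : HeapConditions L f) where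
  open HeapConditions hc

  labelled? : ∀ ℓ → Decidable (λ p → f p ≡ ℓ)
  labelled? ℓ p = f p ≟ ℓ

  absent? : ∀ ℓ i k → Dec (Absent f ℓ i k)
  absent? ℓ i k with anyUpTo? (λ p → (i <? p) ×-dec labelled? ℓ p) k
  ... | yes (p , p<k , i<p , fp) = no λ absent → absent p i<p p<k fp
  ... | no none = yes λ p i<p p<k fp → none (p , p<k , i<p , fp)

  first-occurrence : ∀ ℓ a p → a < p → f p ≡ ℓ →
    Σ ℕ λ q → a < q × q ≤ p × f q ≡ ℓ × Absent f ℓ a q
  first-occurrence ℓ = least-above (labelled? ℓ)

  last-occurrence : ∀ ℓ b p → p < b → f p ≡ ℓ →
    Σ ℕ λ q → p ≤ q × q < b × f q ≡ ℓ × Absent f ℓ q b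
  last-occurrence ℓ = greatest-below (labelled? ℓ)

  occurs-before? : ∀ ℓ b → Dec (∃ λ p → p < b × f p ≡ ℓ)
  occurs-before? ℓ = anyUpTo? (labelled? ℓ)

  conflicts-before? : ∀ ℓ b → Dec (∃ λ p → p < b × Conflict (f p) ℓ)
  conflicts-before? ℓ = anyUpTo? (λ p → conflict? (f p) ℓ)

  repeat-needs-two-neighbours : ∀ ℓ p q z → p < q → q < L → f p ≡ ℓ → f q ≡ ℓ →
    (∀ r → p < r → r < q → AdjN ℓ (f r) → r ≡ z) → ⊥
  repeat-needs-two-neighbours ℓ p q z p<q q<L fp fq only-z with first-occurrence ℓ p q p<q fq
  ... | q′ , p<q′ , q′≤q , fq′ , absent =
    two-neighbours-between ℓ p q′ p<q′ (≤-<-trans q′≤q q<L) fp fq′ absent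
      λ p₁ p₂ p<p₁ p₁<p₂ p₂<q′ a₁ a₂ →
        let p₂<q = <-≤-trans p₂<q′ q′≤q in
        <-irrefl (trans (only-z p₁ p<p₁ (<-trans p₁<p₂ p₂<q) a₁)
                        (sym (only-z p₂ (<-trans p<p₁ p₁<p₂) p₂<q a₂))) p₁<p₂

  leaf-repeat-needs-2 : ∀ p q → p < q → q < L → f p ≡ f q → Leaf (f p) → Absent f 2 p q → ⊥
  leaf-repeat-needs-2 p q p<q q<L fp≡fq leaf no-2 =
    repeat-needs-two-neighbours (f p) p q p p<q q<L refl (sym fp≡fq)
      λ r p<r r<q a → ⊥-elim (no-2 r p<r r<q (leaf-adj leaf a))

  leaf-around-2 : ∀ p z q → p < z → z < q → q < L → f p ≡ f q → Leaf (f p) → OnlyAt f 2 p q z → ⊥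
  leaf-around-2 p z q p<z z<q q<L fp≡fq leaf only-2 =
    repeat-needs-two-neighbours (f p) p q z (<-trans p<z z<q) q<L refl (sym fp≡fq)
      λ r p<r r<q a → only-2 r p<r r<q (leaf-adj leaf a)

  -- Between two occurrences of 3 + j the neighbours are all 4 + j, and recursing on those
  -- runs out of positions.
  chain-repeat-needs-lower : ∀ fuel j i k → k < fuel → i < k → k < L → f i ≡ 3 + j → f k ≡ 3 + j →
                             Absent f (2 + j) i k → ⊥
  chain-repeat-needs-lower (suc fuel) j i k k<fuel i<k k<L fi fk no-lower
    with first-occurrence (3 + j) i k i<k fk
  ... | k′ , i<k′ , k′≤k , fk′ , no-repeat =
    two-neighbours-between (3 + j) i k′ i<k′ (≤-<-trans k′≤k k<L) fi fk′ no-repeat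
      λ p₁ p₂ i<p₁ p₁<p₂ p₂<k′ a₁ a₂ →
        let p₂<k = <-≤-trans p₂<k′ k′≤k in
        chain-repeat-needs-lower fuel (suc j) p₁ p₂ (<-≤-trans p₂<k (≤-pred k<fuel)) p₁<p₂ (<-trans p₂<k k<L)
          (upper p₁ i<p₁ (<-trans p₁<p₂ p₂<k) a₁) (upper p₂ (<-trans i<p₁ p₁<p₂) p₂<k a₂)
          λ r p₁<r r<p₂ → no-repeat r (<-trans i<p₁ p₁<r) (<-trans r<p₂ p₂<k′)
    where
    upper : ∀ p → i < p → p < k → AdjN (3 + j) (f p) → f p ≡ 4 + j
    upper p i<p p<k a with adj-from-3+ j a
    ... | inj₁ e = ⊥-elim (no-lower p i<p p<k e)
    ... | inj₂ e = e

  -- In the first gap both neighbours of 2 + j are its lower neighbour (a leaf when j = 0), and so is one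
  -- in the second gap; the occurrences of it nearest to the middle copy form the same configuration one
  -- step down the chain.
  consecutive-triple-needs-upper : ∀ j z₁ z₂ z₃ z → z₁ < z₂ → z₂ < z₃ → z₃ < L →
    f z₁ ≡ 2 + j → f z₂ ≡ 2 + j → f z₃ ≡ 2 + j → Absent f (2 + j) z₁ z₂ → Absent f (2 + j) z₂ z₃ →
    Absent f (3 + j) z₁ z₂ → OnlyAt f (3 + j) z₂ z₃ z → ⊥
  consecutive-triple-needs-upper zero z₁ z₂ z₃ z z₁<z₂ z₂<z₃ z₃<L f₁ f₂ f₃ no-2₁₂ no-2₂₃ no-3₁₂ only-3 =
    two-neighbours-between 2 z₁ z₂ z₁<z₂ z₂<L f₁ f₂ no-2₁₂ λ p₁ p₂ z₁<p₁ p₁<p₂ p₂<z₂ a₁ a₂ →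
    two-neighbours-between 2 z₂ z₃ z₂<z₃ z₃<L f₂ f₃ no-2₂₃ λ q₁ q₂ z₂<q₁ q₁<q₂ q₂<z₃ b₁ b₂ →
      no-leaf-matches p₁ p₂ z₁<p₁ p₁<p₂ p₂<z₂ (first-gap-leaf p₁ z₁<p₁ (<-trans p₁<p₂ p₂<z₂) a₁)
        (first-gap-leaf p₂ (<-trans z₁<p₁ p₁<p₂) p₂<z₂ a₂) (second-gap-leaf q₁ q₂ z₂<q₁ q₁<q₂ q₂<z₃ b₁ b₂)
    where
    z₂<L = <-trans z₂<z₃ z₃<L
    first-gap-leaf : ∀ p → z₁ < p → p < z₂ → AdjN 2 (f p) → Leaf (f p)
    first-gap-leaf p z₁<p p<z₂ a with adj-from-2-leaf a
    ... | inj₁ leaf = leaf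
    ... | inj₂ e = ⊥-elim (no-3₁₂ p z₁<p p<z₂ e)
    second-gap-leaf : ∀ q₁ q₂ → z₂ < q₁ → q₁ < q₂ → q₂ < z₃ → AdjN 2 (f q₁) → AdjN 2 (f q₂) →
                      Σ ℕ λ q → z₂ < q × q < z₃ × Leaf (f q)
    second-gap-leaf q₁ q₂ z₂<q₁ q₁<q₂ q₂<z₃ b₁ b₂ with adj-from-2-leaf b₁ | adj-from-2-leaf b₂
    ... | inj₁ leaf | _ = q₁ , z₂<q₁ , <-trans q₁<q₂ q₂<z₃ , leaf
    ... | _ | inj₁ leaf = q₂ , <-trans z₂<q₁ q₁<q₂ , q₂<z₃ , leaf
    ... | inj₂ e₁ | inj₂ e₂ = ⊥-elim (only-at-twice only-3 z₂<q₁ q₁<q₂ q₂<z₃ e₁ e₂)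
    across : ∀ p q → z₁ < p → p < z₂ → z₂ < q → q < z₃ → f p ≡ f q → Leaf (f p) → ⊥
    across p q z₁<p p<z₂ z₂<q q<z₃ e leaf =
      leaf-around-2 p z₂ q p<z₂ z₂<q (<-trans q<z₃ z₃<L) e leaf
        (only-at (absent-within no-2₁₂ (<⇒≤ z₁<p) ≤-refl) (absent-within no-2₂₃ ≤-refl (<⇒≤ q<z₃)))
    no-leaf-matches : ∀ p₁ p₂ → z₁ < p₁ → p₁ < p₂ → p₂ < z₂ → Leaf (f p₁) → Leaf (f p₂) →
                      ¬ (Σ ℕ λ q → z₂ < q × q < z₃ × Leaf (f q))
    no-leaf-matches p₁ p₂ z₁<p₁ p₁<p₂ p₂<z₂ leaf₁ leaf₂ (q , z₂<q , q<z₃ , leaf)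
      with f p₁ ≟ f q | f p₂ ≟ f q
    ... | yes e | _ = across p₁ q z₁<p₁ (<-trans p₁<p₂ p₂<z₂) z₂<q q<z₃ e leaf₁
    ... | no _ | yes e = across p₂ q (<-trans z₁<p₁ p₁<p₂) p₂<z₂ z₂<q q<z₃ e leaf₂
    ... | no ≢₁ | no ≢₂ =
      leaf-repeat-needs-2 p₁ p₂ p₁<p₂ (<-trans p₂<z₂ z₂<L) (sym (leaf-third leaf₁ leaf leaf₂ ≢₁ ≢₂)) leaf₁
        (absent-within no-2₁₂ (<⇒≤ z₁<p₁) (<⇒≤ p₂<z₂))
  consecutive-triple-needs-upper (suc j) z₁ z₂ z₃ z z₁<z₂ z₂<z₃ z₃<L f₁ f₂ f₃ no-3₁₂ no-3₂₃ no-4₁₂ only-4 =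
    two-neighbours-between (3 + j) z₁ z₂ z₁<z₂ z₂<L f₁ f₂ no-3₁₂ λ p₁ p₂ z₁<p₁ p₁<p₂ p₂<z₂ a₁ a₂ →
    two-neighbours-between (3 + j) z₂ z₃ z₂<z₃ z₃<L f₂ f₃ no-3₂₃ λ q₁ q₂ z₂<q₁ q₁<q₂ q₂<z₃ b₁ b₂ →
      let q , z₂<q , q<z₃ , fq = second-gap-lower q₁ q₂ z₂<q₁ q₁<q₂ q₂<z₃ b₁ b₂ in
      descend p₁ p₂ z₁<p₁ p₁<p₂ p₂<z₂ (first-gap-lower p₁ z₁<p₁ (<-trans p₁<p₂ p₂<z₂) a₁)
        (first-gap-lower p₂ (<-trans z₁<p₁ p₁<p₂) p₂<z₂ a₂) q z₂<q q<z₃ fq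
    where
    z₂<L = <-trans z₂<z₃ z₃<L
    first-gap-lower : ∀ p → z₁ < p → p < z₂ → AdjN (3 + j) (f p) → f p ≡ 2 + j
    first-gap-lower p z₁<p p<z₂ a with adj-from-3+ j a
    ... | inj₁ e = e
    ... | inj₂ e = ⊥-elim (no-4₁₂ p z₁<p p<z₂ e)
    second-gap-lower : ∀ q₁ q₂ → z₂ < q₁ → q₁ < q₂ → q₂ < z₃ → AdjN (3 + j) (f q₁) → AdjN (3 + j) (f q₂) →
                       Σ ℕ λ q → z₂ < q × q < z₃ × f q ≡ 2 + j
    second-gap-lower q₁ q₂ z₂<q₁ q₁<q₂ q₂<z₃ b₁ b₂ with adj-from-3+ j b₁ | adj-from-3+ j b₂
    ... | inj₁ e | _ = q₁ , z₂<q₁ , <-trans q₁<q₂ q₂<z₃ , e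
    ... | _ | inj₁ e = q₂ , <-trans z₂<q₁ q₁<q₂ , q₂<z₃ , e
    ... | inj₂ e₁ | inj₂ e₂ = ⊥-elim (only-at-twice only-4 z₂<q₁ q₁<q₂ q₂<z₃ e₁ e₂)
    descend : ∀ p₁ p₂ → z₁ < p₁ → p₁ < p₂ → p₂ < z₂ → f p₁ ≡ 2 + j → f p₂ ≡ 2 + j →
              ∀ q → z₂ < q → q < z₃ → f q ≡ 2 + j → ⊥
    descend p₁ p₂ z₁<p₁ p₁<p₂ p₂<z₂ fp₁ fp₂ q z₂<q q<z₃ fq
      with last-occurrence (2 + j) z₂ p₂ p₂<z₂ fp₂
    ... | y₂ , p₂≤y₂ , y₂<z₂ , fy₂ , no-2₂ with last-occurrence (2 + j) y₂ p₁ (<-≤-trans p₁<p₂ p₂≤y₂) fp₁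
    ... | y₁ , p₁≤y₁ , y₁<y₂ , fy₁ , no-2₁ with first-occurrence (2 + j) z₂ q z₂<q fq
    ... | y₃ , z₂<y₃ , y₃≤q , fy₃ , no-2₃ =
      consecutive-triple-needs-upper j y₁ y₂ y₃ z₂ y₁<y₂ (<-trans y₂<z₂ z₂<y₃)
        (≤-<-trans y₃≤q (<-trans q<z₃ z₃<L)) fy₁ fy₂ fy₃ no-2₁
        (absent-across no-2₂ (λ e → 1+n≢n (trans (sym f₂) e)) no-2₃)
        (absent-within no-3₁₂ (<⇒≤ z₁<y₁) (<⇒≤ y₂<z₂))
        (only-at (absent-within no-3₁₂ (<⇒≤ z₁<y₂) ≤-refl)
                 (absent-within no-3₂₃ ≤-refl (≤-trans y₃≤q (<⇒≤ q<z₃))))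
      where
      z₁<y₁ = <-≤-trans z₁<p₁ p₁≤y₁
      z₁<y₂ = <-trans z₁<y₁ y₁<y₂

  -- The last occurrence of the leaf f p₀ before z and z form a noncommuting prefix.
  one-leaf-kind-before-fork : ∀ z p₀ d → p₀ < z → z < L → f z ≡ 2 → AbsentBefore f 2 z → AbsentBefore f 3 z →
                              Leaf (f p₀) → Leaf d → AbsentBefore f d z → ⊥
  one-leaf-kind-before-fork z p₀ d p₀<z z<L fz no-2 no-3 leaf₀ leaf-d no-d
    with last-occurrence (f p₀) z p₀ p₀<z refl
  ... | r , _ , r<z , fr , no-p₀-after-r =
    no-noncommuting-prefix r z r<z z<L (subst₂ AdjN (sym fr) (sym fz) (leaf-adj-2 leaf₀)) r-minimal z-only-above-r
    where
    leaf-r : Leaf (f r)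
    leaf-r = subst Leaf (sym fr) leaf₀
    no-2-before-r : ∀ p → Absent f 2 p r
    no-2-before-r p = absent-before⇒absent λ t t<r → no-2 t (<-trans t<r r<z)
    r-minimal : ∀ p → p < r → Commute (f p) (f r)
    r-minimal p p<r (inj₁ e) =
      leaf-repeat-needs-2 p r p<r (<-trans r<z z<L) e (subst Leaf (sym e) leaf-r) (no-2-before-r p)
    r-minimal p p<r (inj₂ a) = no-2 p (<-trans p<r r<z) (leaf-adj leaf-r (adj-sym a))
    no-other-p₀ : ∀ p → p < z → p ≢ r → Leaf (f p) → f p ≢ f p₀
    no-other-p₀ p p<z p≢r leaf-p e with <-cmp p r
    ... | tri< p<r _ _ = leaf-repeat-needs-2 p r p<r (<-trans r<z z<L) (trans e (sym fr)) leaf-p (no-2-before-r p)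
    ... | tri≈ _ p≡r _ = p≢r p≡r
    ... | tri> _ _ r<p = no-p₀-after-r p r<p p<z e
    z-only-above-r : ∀ p → p < z → p ≢ r → Commute (f p) (f z)
    z-only-above-r p p<z p≢r c with subst (Conflict (f p)) fz c
    ... | inj₁ e = no-2 p p<z e
    ... | inj₂ a with adj-from-2-leaf (adj-sym a)
    ... | inj₂ e = no-3 p p<z e
    ... | inj₁ leaf-p with f p ≟ d
    ... | yes e = no-d p p<z e
    ... | no f-p≢d = no-other-p₀ p p<z p≢r leaf-p
                       (leaf-third leaf₀ leaf-d leaf-p (λ e → no-d p₀ p₀<z e) f-p≢d)

  record InitialPeak (j z₁ m z₂ : ℕ) : Set where
    field
      z₁<m : z₁ < m
      m<z₂ : m < z₂
      z₂<L : z₂ < L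
      f-z₁ : f z₁ ≡ 2 + j
      f-z₂ : f z₂ ≡ 2 + j
      f-m : f m ≡ 3 + j
      no-lower-between : Absent f (2 + j) z₁ z₂
      upper-only-at-m : OnlyAt f (3 + j) z₁ z₂ m
      no-upper-before : AbsentBefore f (3 + j) z₁
      no-next-before : AbsentBefore f (4 + j) m

  no-initial-peak-after-leaf : ∀ z₁ m z₂ → InitialPeak 0 z₁ m z₂ → AbsentBefore f 2 z₁ →
                               ∀ p₀ → p₀ < z₁ → AdjN 2 (f p₀) → ⊥
  no-initial-peak-after-leaf z₁ m z₂ peak no-2-before p₀ p₀<z₁ a =
    two-neighbours-between 2 z₁ z₂ (<-trans z₁<m m<z₂) z₂<L f-z₁ f-z₂ no-lower-between
      λ q₁ q₂ z₁<q₁ q₁<q₂ q₂<z₂ b₁ b₂ → case adj-from-2-leaf b₁ ,′ adj-from-2-leaf b₂ of λ where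
        (inj₁ leaf , _) → leaf-after q₁ z₁<q₁ (<-trans q₁<q₂ q₂<z₂) leaf
        (_ , inj₁ leaf) → leaf-after q₂ (<-trans z₁<q₁ q₁<q₂) q₂<z₂ leaf
        (inj₂ e₁ , inj₂ e₂) → only-at-twice upper-only-at-m z₁<q₁ q₁<q₂ q₂<z₂ e₁ e₂
    where
    open InitialPeak peak
    z₁<L = <-trans z₁<m (<-trans m<z₂ z₂<L)
    leaf₀ : Leaf (f p₀)
    leaf₀ with adj-from-2-leaf a
    ... | inj₁ leaf = leaf
    ... | inj₂ e = ⊥-elim (no-upper-before p₀ p₀<z₁ e)
    leaf-after : ∀ q → z₁ < q → q < z₂ → Leaf (f q) → ⊥
    leaf-after q z₁<q q<z₂ leaf with occurs-before? (f q) z₁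
    ... | yes (p , p<z₁ , fp) =
      leaf-around-2 p z₁ q p<z₁ z₁<q (<-trans q<z₂ z₂<L) fp (subst Leaf (sym fp) leaf)
        (only-at (absent-before⇒absent no-2-before)
                 (absent-within no-lower-between ≤-refl (<⇒≤ q<z₂)))
    ... | no other-leaf-absent =
      one-leaf-kind-before-fork z₁ p₀ (f q) p₀<z₁ z₁<L f-z₁ no-2-before no-upper-before leaf₀ leaf
        (¬occurs⇒absent-before other-leaf-absent)

  no-initial-peak : ∀ j z₁ m z₂ → InitialPeak j z₁ m z₂ → ⊥

  no-initial-peak-after-conflict : ∀ j z₁ m z₂ → InitialPeak j z₁ m z₂ → AbsentBefore f (2 + j) z₁ →
                                   ∀ p₀ → p₀ < z₁ → Conflict (f p₀) (2 + j) → ⊥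

  no-initial-peak j z₁ m z₂ peak with occurs-before? (2 + j) z₁
  ... | yes (p , p<z₁ , fp) with last-occurrence (2 + j) z₁ p p<z₁ fp
  ... | z₀ , _ , z₀<z₁ , f-z₀ , no-lower =
    consecutive-triple-needs-upper j z₀ z₁ z₂ m z₀<z₁ (<-trans z₁<m m<z₂) z₂<L f-z₀ f-z₁ f-z₂
      no-lower no-lower-between (absent-before⇒absent no-upper-before) upper-only-at-m
    where open InitialPeak peak
  no-initial-peak j z₁ m z₂ peak | no no-lower-before with conflicts-before? (2 + j) z₁
  ... | yes (p₀ , p₀<z₁ , c) =
    no-initial-peak-after-conflict j z₁ m z₂ peak (¬occurs⇒absent-before no-lower-before) p₀ p₀<z₁ c
  ... | no z₁-minimal =
    no-noncommuting-prefix z₁ m z₁<m (<-trans m<z₂ z₂<L) (subst₂ AdjN (sym f-z₁) (sym f-m) (adj-chain j))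
      (λ p p<z₁ c → z₁-minimal (p , p<z₁ , subst (Conflict (f p)) f-z₁ c))
      m-only-above-z₁
    where
    open InitialPeak peak
    m-only-above-z₁ : ∀ p → p < m → p ≢ z₁ → Commute (f p) (f m)
    m-only-above-z₁ p p<m p≢z₁ c with <-cmp p z₁ | subst (Conflict (f p)) f-m c
    ... | tri≈ _ e _ | _ = p≢z₁ e
    ... | tri< p<z₁ _ _ | inj₁ e = no-upper-before p p<z₁ e
    ... | tri> _ _ z₁<p | inj₁ e = <-irrefl (upper-only-at-m p z₁<p (<-trans p<m m<z₂) e) p<m
    ... | tri< p<z₁ _ _ | inj₂ a with adj-from-3+ j (adj-sym a)
    ... | inj₁ e = no-lower-before (p , p<z₁ , e)
    ... | inj₂ e = no-next-before p p<m e
    m-only-above-z₁ p p<m p≢z₁ c | tri> _ _ z₁<p | inj₂ a with adj-from-3+ j (adj-sym a)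
    ... | inj₁ e = no-lower-between p z₁<p (<-trans p<m m<z₂) e
    ... | inj₂ e = no-next-before p p<m e

  no-initial-peak-after-conflict j z₁ m z₂ peak no-lower-before p₀ p₀<z₁ (inj₁ e) =
    no-lower-before p₀ p₀<z₁ e
  no-initial-peak-after-conflict zero z₁ m z₂ peak no-2-before p₀ p₀<z₁ (inj₂ a) =
    no-initial-peak-after-leaf z₁ m z₂ peak no-2-before p₀ p₀<z₁ (adj-sym a)
  no-initial-peak-after-conflict (suc j) z₁ m z₂ peak no-upper-before′ p₀ p₀<z₁ (inj₂ a)
    with adj-from-3+ j (adj-sym a)
  ... | inj₂ e = InitialPeak.no-upper-before peak p₀ p₀<z₁ e
  ... | inj₁ e with last-occurrence (2 + j) z₁ p₀ p₀<z₁ e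
  ... | y , _ , y<z₁ , f-y , no-lower-after-y =
    two-neighbours-between (3 + j) z₁ z₂ (<-trans z₁<m m<z₂) z₂<L f-z₁ f-z₂ no-lower-between
      λ q₁ q₂ z₁<q₁ q₁<q₂ q₂<z₂ b₁ b₂ → case adj-from-3+ j b₁ ,′ adj-from-3+ j b₂ of λ where
        (inj₁ e₁ , _) → lower-peak q₁ z₁<q₁ (<-trans q₁<q₂ q₂<z₂) e₁
        (_ , inj₁ e₂) → lower-peak q₂ (<-trans z₁<q₁ q₁<q₂) q₂<z₂ e₂
        (inj₂ e₁ , inj₂ e₂) → only-at-twice upper-only-at-m z₁<q₁ q₁<q₂ q₂<z₂ e₁ e₂
    where
    open InitialPeak peak
    lower-peak : ∀ q → z₁ < q → q < z₂ → f q ≡ 2 + j → ⊥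
    lower-peak q z₁<q q<z₂ fq with first-occurrence (2 + j) z₁ q z₁<q fq
    ... | y′ , z₁<y′ , y′≤q , f-y′ , no-lower-before-y′ = no-initial-peak j y z₁ y′ record
      { z₁<m = y<z₁
      ; m<z₂ = z₁<y′
      ; z₂<L = ≤-<-trans y′≤q (<-trans q<z₂ z₂<L)
      ; f-z₁ = f-y
      ; f-z₂ = f-y′
      ; f-m = f-z₁
      ; no-lower-between = absent-across no-lower-after-y (λ e′ → 1+n≢n (trans (sym f-z₁) e′)) no-lower-before-y′
      ; upper-only-at-m = only-at (absent-before⇒absent no-upper-before′)
                                  (absent-within no-lower-between ≤-refl (≤-trans y′≤q (<⇒≤ q<z₂)))
      ; no-upper-before = λ p p<y → no-upper-before′ p (<-trans p<y y<z₁)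
      ; no-next-before = no-upper-before
      }
  -- Unless b is minimal, the last 4 + j before b plays the role of b one step up the chain.
  no-initial-descent : ∀ fuel j b a → b < fuel → b < a → a < L → f b ≡ 3 + j → f a ≡ 2 + j →
                       AbsentBefore f (2 + j) b → (∀ p → p < a → p ≢ b → Commute (f p) (2 + j)) → ⊥
  no-initial-descent (suc fuel) j b a b<fuel b<a a<L fb fa no-lower-before a-only-above-b
    with conflicts-before? (3 + j) b
  ... | no b-minimal =
    no-noncommuting-prefix b a b<a a<L (subst₂ AdjN (sym fb) (sym fa) (adj-sym (adj-chain j)))
      (λ p p<b c → b-minimal (p , p<b , subst (Conflict (f p)) fb c))
      (λ p p<a p≢b c → a-only-above-b p p<a p≢b (subst (Conflict (f p)) fa c))
  ... | yes (p₀ , p₀<b , c) = conflict-before-b c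
    where
    no-upper-before : ∀ p → p < b → f p ≢ 3 + j
    no-upper-before p p<b e = a-only-above-b p (<-trans p<b b<a) (<⇒≢ p<b)
                                (inj₂ (subst (λ x → AdjN x (2 + j)) (sym e) (adj-sym (adj-chain j))))
    conflict-before-b : Conflict (f p₀) (3 + j) → ⊥
    conflict-before-b (inj₁ e) = no-upper-before p₀ p₀<b e
    conflict-before-b (inj₂ a₀) with adj-from-3+ j (adj-sym a₀)
    ... | inj₁ e = no-lower-before p₀ p₀<b e
    ... | inj₂ e with last-occurrence (4 + j) b p₀ p₀<b e
    ... | g , _ , g<b , fg , no-next-after-g =
      no-initial-descent fuel (suc j) g b (<-≤-trans g<b (≤-pred b<fuel)) g<b (<-trans b<a a<L) fg fb
        (λ p p<g → no-upper-before p (<-trans p<g g<b)) b-only-above-g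
      where
      b-only-above-g : ∀ p → p < b → p ≢ g → Commute (f p) (3 + j)
      b-only-above-g p p<b p≢g (inj₁ e′) = no-upper-before p p<b e′
      b-only-above-g p p<b p≢g (inj₂ a′) with adj-from-3+ j (adj-sym a′)
      ... | inj₁ e′ = no-lower-before p p<b e′
      ... | inj₂ e′ with <-cmp p g
      ... | tri< p<g _ _ = chain-repeat-needs-lower (suc g) (suc j) p g ≤-refl p<g (<-trans g<b (<-trans b<a a<L))
                             e′ fg (absent-before⇒absent λ r r<g → no-upper-before r (<-trans r<g g<b))
      ... | tri≈ _ p≡g _ = p≢g p≡g
      ... | tri> _ _ g<p = no-next-after-g p g<p p<b e′

  Maximal : ℕ → Set
  Maximal s = ∀ p → s < p → p < L → Commute (f p) (f s)

  NonMinimal : ℕ → Set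
  NonMinimal s = ∃ λ p → p < s × Conflict (f p) (f s)

  nonminimal? : Decidable NonMinimal
  nonminimal? s = anyUpTo? (λ p → conflict? (f p) (f s)) s

  Top : ℕ → Set
  Top s = s < L × Maximal s × NonMinimal s

  last-conflict-before : ∀ s → NonMinimal s →
    Σ ℕ λ x → x < s × Conflict (f x) (f s) × (∀ r → x < r → r < s → Commute (f r) (f s))
  last-conflict-before s (p , p<s , c) with greatest-below (λ p → conflict? (f p) (f s)) s p p<s c
  ... | x , _ , x<s , cx , x-last = x , x<s , cx , x-last

  HigherTop : ℕ → Set
  HigherTop s = Σ ℕ λ s′ → Top s′ × rank (f s) < rank (f s′)

  -- The last non-minimal position after r with label in T is maximal, because leaving T by a
  -- conflict needs the label g.
  climb : ∀ {T : ℕ → Set} → Decidable T → ∀ g → (∀ a x → T a → Conflict x a → T x ⊎ x ≡ g) →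
          ∀ r → r < L → T (f r) → NonMinimal r → (∀ p → r < p → p < L → f p ≢ g) →
          Σ ℕ λ s → Top s × T (f s)
  climb T? g closed r r<L Tr r-nonminimal no-g
    with greatest-below (λ p → T? (f p) ×-dec nonminimal? p) L r r<L (Tr , r-nonminimal)
  ... | s , r≤s , s<L , (Ts , s-nonminimal) , last = s , (s<L , maximal , s-nonminimal) , Ts
    where
    maximal : Maximal s
    maximal p s<p p<L c with closed (f s) (f p) Ts c
    ... | inj₁ Tp = last p s<p p<L (Tp , s , s<p , conflict-sym c)
    ... | inj₂ e = no-g p (≤-<-trans r≤s s<p) p<L e

  module AtTop (s : ℕ) (s<L : s < L) (maximal : Maximal s) (nonminimal : NonMinimal s) where

    self-absent-after : Absent f (f s) s L
    self-absent-after p s<p p<L e = maximal p s<p p<L (inj₁ e)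

    self-only-at-s : ∀ q y → Absent f (f s) q s → q < y → y ≢ s → y < L → f y ≢ f s
    self-only-at-s q y no-s q<y y≢s y<L e = y≢s (only-at no-s self-absent-after y q<y y<L e)

    commute-after⇒self-absent : ∀ x → (∀ r → x < r → r < s → Commute (f r) (f s)) → Absent f (f s) x s
    commute-after⇒self-absent x x-last r x<r r<s e = x-last r x<r r<s (inj₁ e)

    ChildBelow : ℕ → Set
    ChildBelow q = Child (f s) (f q) × Absent f (f s) q s

    child-below? : Decidable ChildBelow
    child-below? q = child? (f s) (f q) ×-dec absent? (f s) q s

    from-child : ∀ q → q < s → ChildBelow q → HigherTop s
    from-child q₀ q₀<s c₀ with greatest-below child-below? s q₀ q₀<s c₀
    ... | q , _ , q<s , (child , no-s) , last-child
      with anyUpTo? (λ r → (q <? r) ×-dec ¬? (r ≟ s) ×-dec conflict? (f r) (f q)) L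
    ... | no none = ⊥-elim (no-noncommuting-suffix q s q<s s<L (child⇒adj (f s) (f q) child) maximal
                              λ p q<p p<L p≢s c → none (p , p<L , q<p , p≢s , c))
    ... | yes (r , r<L , q<r , r≢s , c) = via-grandchild c
      where
      g = f q
      no-g-after : ∀ p → q < p → p < L → f p ≢ g
      no-g-after p q<p p<L e with <-cmp p s
      ... | tri< p<s _ _ = last-child p q<p p<s
                             (subst (Child (f s)) (sym e) child , absent-within no-s (<⇒≤ q<p) ≤-refl)
      ... | tri≈ _ refl _ = child-irrefl (f s) (f q) child (sym e)
      ... | tri> _ _ s<p = maximal p s<p p<L (inj₂ (subst (λ z → AdjN z (f s)) (sym e) (child⇒adj (f s) g child)))
      via-grandchild : Conflict (f r) g → HigherTop s
      via-grandchild (inj₁ e) = ⊥-elim (no-g-after r q<r r<L e)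
      via-grandchild (inj₂ a) with f r ≟ f s
      ... | yes e = ⊥-elim (self-only-at-s q r no-s q<r r≢s r<L e)
      ... | no fr≢fs
        with climb (below? g) g (below-conflict-closed g) r r<L (grandchild-below (f s) g (f r) child a fr≢fs)
                   (q , q<r , inj₂ (adj-sym a)) (λ p r<p p<L → no-g-after p (<-trans q<r r<p) p<L)
      ... | s′ , top′ , below = s′ , top′ , rank-below (f s) g (f s′) child below

    module FromParent (no-child : ∀ q → q < s → ¬ ChildBelow q) (x : ℕ) (x<s : x < s)
                      (parent : Parent (f s) (f x)) (x-last : ∀ r → x < r → r < s → Commute (f r) (f s)) where

      x<L : x < L
      x<L = <-trans x<s s<L

      adj-xs : AdjN (f x) (f s)
      adj-xs = parent⇒adj (f s) (f x) parent

      self-absent-after-x : Absent f (f s) x s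
      self-absent-after-x = commute-after⇒self-absent x x-last

      parent-absent-after : ∀ ℓ → f x ≡ ℓ → ∀ k → k ≤ L → Absent f ℓ x k
      parent-absent-after .(f x) refl k k≤L p x<p p<k e with <-cmp p s
      ... | tri< p<s _ _ = x-last p x<p p<s (inj₂ (subst (λ z → AdjN z (f s)) (sym e) adj-xs))
      ... | tri≈ _ refl _ = parent-irrefl (f s) (f x) parent (sym e)
      ... | tri> _ _ s<p = maximal p s<p (<-≤-trans p<k k≤L) (inj₂ (subst (λ z → AdjN z (f s)) (sym e) adj-xs))

      -- An earlier f s would need two neighbours before s, but children are excluded and the parent
      -- occurs only at x.
      no-self-before-parent : ∀ p → p < x → f p ≡ f s → Absent f (f x) p x → ⊥
      no-self-before-parent p p<x fp no-x with last-occurrence (f s) s p (<-trans p<x x<s) fp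
      ... | u , p≤u , u<s , fu , no-s-after-u with <-cmp u x
      ... | tri> _ _ x<u = x-last u x<u u<s (inj₁ fu)
      ... | tri≈ _ refl _ = parent-irrefl (f s) (f x) parent fu
      ... | tri< u<x _ _ = repeat-needs-two-neighbours (f s) u s x u<s s<L fu refl neighbour-at-x
        where
        neighbour-at-x : ∀ t → u < t → t < s → AdjN (f s) (f t) → t ≡ x
        neighbour-at-x t u<t t<s a with <-cmp t x
        ... | tri≈ _ t≡x _ = t≡x
        ... | tri> _ _ x<t = ⊥-elim (x-last t x<t t<s (inj₂ (adj-sym a)))
        ... | tri< t<x _ _ with adj⇒child⊎parent (f s) (f t) (adj-sym a)
        ... | inj₁ child = ⊥-elim (no-child t t<s (child , absent-within no-s-after-u (<⇒≤ u<t) ≤-refl))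
        ... | inj₂ parent′ =
          ⊥-elim (no-x t (≤-<-trans p≤u u<t) t<x (parent-unique (f s) (f t) (f x) parent′ parent))

      no-self-between : ∀ {ℓ ℓ′} x′ → f x ≡ ℓ → f s ≡ ℓ′ → Absent f ℓ x′ x → Absent f ℓ′ x′ x
      no-self-between x′ refl refl no-x r x′<r r<x e =
        no-self-before-parent r r<x e (absent-within no-x (<⇒≤ x′<r) ≤-refl)

      no-self-before : ∀ {ℓ ℓ′} → f x ≡ ℓ → f s ≡ ℓ′ → AbsentBefore f ℓ x → AbsentBefore f ℓ′ x
      no-self-before refl refl no-x p p<x e = no-self-before-parent p p<x e (absent-before⇒absent no-x)

      -- If x were minimal then everything before x would commute with f s as well: an f s or a child
      -- of f s would contradict the choice of s, and the parent is f x itself.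
      parent-not-minimal : (∀ p → p < x → Commute (f p) (f x)) → ⊥
      parent-not-minimal x-minimal = no-noncommuting-prefix x s x<s s<L adj-xs x-minimal s-only-above-x
        where
        no-parent-before : AbsentBefore f (f x) x
        no-parent-before p p<x e = x-minimal p p<x (inj₁ e)
        no-self-before-x : AbsentBefore f (f s) x
        no-self-before-x = no-self-before refl refl no-parent-before
        s-only-above-x : ∀ p → p < s → p ≢ x → Commute (f p) (f s)
        s-only-above-x p p<s p≢x c with <-cmp p x
        ... | tri≈ _ p≡x _ = p≢x p≡x
        ... | tri> _ _ x<p = x-last p x<p p<s c
        ... | tri< p<x _ _ with c
        ... | inj₁ e = no-self-before-x p p<x e
        ... | inj₂ a with adj⇒child⊎parent (f s) (f p) a
        ... | inj₂ parent′ = no-parent-before p p<x (parent-unique (f s) (f p) (f x) parent′ parent)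
        ... | inj₁ child = no-child p p<s (child , absent-across (absent-before⇒absent no-self-before-x)
                                                     (parent-irrefl (f s) (f x) parent) self-absent-after-x)

      -- The cases below are named, in generator notation, by f s and by the label of a neighbour y of
      -- f x that occurs after x.

      s₂-then-s₁ : f s ≡ 1 → f x ≡ 2 → ∀ y → x < y → y < L → f y ≡ 0 → ⊥
      s₂-then-s₁ fs fx y x<y y<L fy with occurs-before? 2 x
      ... | yes (p , p<x , fp) with last-occurrence 2 x p p<x fp
      ... | x′ , _ , x′<x , fx′ , no-2 =
        two-neighbours-between 2 x′ x x′<x x<L fx′ fx no-2 λ p₁ p₂ x′<p₁ p₁<p₂ p₂<x a₁ a₂ →
          case adj-from-2-leaf a₁ ,′ adj-from-2-leaf a₂ of λ where
            (inj₁ leaf , _) → no-leaf-after-x′ p₁ x′<p₁ (<-trans p₁<p₂ p₂<x) leaf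
            (_ , inj₁ leaf) → no-leaf-after-x′ p₂ (<-trans x′<p₁ p₁<p₂) p₂<x leaf
            (inj₂ e₁ , inj₂ e₂) → chain-repeat-needs-lower (suc p₂) 0 p₁ p₂ ≤-refl p₁<p₂ (<-trans p₂<x x<L) e₁ e₂
                                    (absent-within no-2 (<⇒≤ x′<p₁) (<⇒≤ p₂<x))
        where
        no-leaf-after-x′ : ∀ p → x′ < p → p < x → Leaf (f p) → ⊥
        no-leaf-after-x′ p x′<p p<x (inj₁ fp≡0) =
          leaf-around-2 p x y p<x x<y y<L (trans fp≡0 (sym fy)) (inj₁ fp≡0)
            (only-at (absent-within no-2 (<⇒≤ x′<p) ≤-refl) (parent-absent-after 2 fx y (<⇒≤ y<L)))
        no-leaf-after-x′ p x′<p p<x (inj₂ fp≡1) =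
          no-self-between x′ fx fs no-2 p x′<p p<x fp≡1
      s₂-then-s₁ fs fx y x<y y<L fy | no no-2 with occurs-before? 0 x
      ... | yes (p , p<x , fp) =
        leaf-around-2 p x y p<x x<y y<L (trans fp (sym fy)) (inj₁ fp)
          (only-at (absent-before⇒absent (¬occurs⇒absent-before no-2)) (parent-absent-after 2 fx y (<⇒≤ y<L)))
      ... | no no-0-before with conflicts-before? 2 x
      ... | no x-minimal = parent-not-minimal λ p p<x c → x-minimal (p , p<x , subst (Conflict (f p)) fx c)
      ... | yes (p₀ , p₀<x , c₀) = below-x c₀
        where
        no-2-before : AbsentBefore f 2 x
        no-2-before = ¬occurs⇒absent-before no-2
        no-1-before : AbsentBefore f 1 x
        no-1-before = no-self-before fx fs no-2-before
        below-x : Conflict (f p₀) 2 → ⊥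
        below-x (inj₁ e) = no-2-before p₀ p₀<x e
        below-x (inj₂ a) with adj-from-2 (adj-sym a)
        ... | inj₁ e = no-0-before (p₀ , p₀<x , e)
        ... | inj₂ (inj₁ e) = no-1-before p₀ p₀<x e
        ... | inj₂ (inj₂ e) with last-occurrence 3 x p₀ p₀<x e
        ... | b , _ , b<x , fb , no-3-after-b =
          no-initial-descent (suc b) 0 b x ≤-refl b<x x<L fb fx (λ r r<b → no-2-before r (<-trans r<b b<x))
            x-only-above-b
          where
          x-only-above-b : ∀ p → p < x → p ≢ b → Commute (f p) 2
          x-only-above-b p p<x p≢b (inj₁ e′) = no-2-before p p<x e′
          x-only-above-b p p<x p≢b (inj₂ a′) with adj-from-2 (adj-sym a′)
          ... | inj₁ e′ = no-0-before (p , p<x , e′)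
          ... | inj₂ (inj₁ e′) = no-1-before p p<x e′
          ... | inj₂ (inj₂ e′) with <-cmp p b
          ... | tri< p<b _ _ = chain-repeat-needs-lower (suc b) 0 p b ≤-refl p<b (<-trans b<x x<L) e′ fb
                                 (absent-before⇒absent λ r r<b → no-2-before r (<-trans r<b b<x))
          ... | tri≈ _ p≡b _ = p≢b p≡b
          ... | tri> _ _ b<p = no-3-after-b p b<p p<x e′

      s₂-then-s₄ : f s ≡ 1 → f x ≡ 2 → ∀ y → x < y → y < L → f y ≡ 3 → HigherTop s
      s₂-then-s₄ fs fx y x<y y<L fy
        with climb (3 ≤?_) 2 ≥3-conflict-closed y y<L (≤-reflexive (sym fy))
                   (x , x<y , inj₂ (subst₂ AdjN (sym fx) (sym fy) (adj-chain 0)))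
                   (λ p y<p p<L → parent-absent-after 2 fx L ≤-refl p (<-trans x<y y<p) p<L)
      ... | s′ , top′ , 3≤fs′ = s′ , top′ , subst (_< rank (f s′)) (cong rank (sym fs)) (higher 3≤fs′)
        where
        higher : 3 ≤ f s′ → rank 1 < rank (f s′)
        higher 3≤fs′ rewrite rank-≥3 (f s′) 3≤fs′ = ≤-trans (s≤s (s≤s (s≤s z≤n))) 3≤fs′

      s₄-then-leaf : f s ≡ 3 → f x ≡ 2 → ∀ y → x < y → y < L → Leaf (f y) → ⊥
      s₄-then-leaf fs fx y x<y y<L leaf-y with occurs-before? 2 x
      ... | yes (p , p<x , fp) with last-occurrence 2 x p p<x fp
      ... | x′ , _ , x′<x , fx′ , no-2 =
        two-neighbours-between 2 x′ x x′<x x<L fx′ fx no-2 λ p₁ p₂ x′<p₁ p₁<p₂ p₂<x a₁ a₂ →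
          let leaf₁ = leaf-after-x′ p₁ x′<p₁ (<-trans p₁<p₂ p₂<x) a₁
              leaf₂ = leaf-after-x′ p₂ (<-trans x′<p₁ p₁<p₂) p₂<x a₂
          in case (f p₁ ≟ f p₂) ,′ (f p₁ ≟ f y) of λ where
            (yes e , _) → leaf-repeat-needs-2 p₁ p₂ p₁<p₂ (<-trans p₂<x x<L) e leaf₁
                            (absent-within no-2 (<⇒≤ x′<p₁) (<⇒≤ p₂<x))
            (no _ , yes e) → matches-y p₁ x′<p₁ (<-trans p₁<p₂ p₂<x) e leaf₁
            (no ≢₁₂ , no ≢₁y) → matches-y p₂ (<-trans x′<p₁ p₁<p₂) p₂<x
                                   (leaf-third leaf-y leaf₁ leaf₂ (≢-sym ≢₁y) (≢-sym ≢₁₂)) leaf₂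
        where
        leaf-after-x′ : ∀ p → x′ < p → p < x → AdjN 2 (f p) → Leaf (f p)
        leaf-after-x′ p x′<p p<x a with adj-from-2-leaf a
        ... | inj₁ leaf = leaf
        ... | inj₂ e = ⊥-elim (no-self-between x′ fx fs no-2 p x′<p p<x e)
        matches-y : ∀ p → x′ < p → p < x → f p ≡ f y → Leaf (f p) → ⊥
        matches-y p x′<p p<x e leaf =
          leaf-around-2 p x y p<x x<y y<L e leaf
            (only-at (absent-within no-2 (<⇒≤ x′<p) ≤-refl) (parent-absent-after 2 fx y (<⇒≤ y<L)))
      s₄-then-leaf fs fx y x<y y<L leaf-y | no no-2 with occurs-before? (f y) x
      ... | yes (p , p<x , fp) =
        leaf-around-2 p x y p<x x<y y<L fp (subst Leaf (sym fp) leaf-y)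
          (only-at (absent-before⇒absent (¬occurs⇒absent-before no-2)) (parent-absent-after 2 fx y (<⇒≤ y<L)))
      ... | no no-y with conflicts-before? 2 x
      ... | no x-minimal = parent-not-minimal λ p p<x c → x-minimal (p , p<x , subst (Conflict (f p)) fx c)
      ... | yes (p₀ , p₀<x , inj₁ e) = no-2 (p₀ , p₀<x , e)
      ... | yes (p₀ , p₀<x , inj₂ a) with adj-from-2-leaf (adj-sym a)
      ... | inj₂ e = no-self-before fx fs (¬occurs⇒absent-before no-2) p₀ p₀<x e
      ... | inj₁ leaf₀ =
        one-leaf-kind-before-fork x p₀ (f y) p₀<x x<L fx (¬occurs⇒absent-before no-2)
          (no-self-before fx fs (¬occurs⇒absent-before no-2)) leaf₀ leaf-y (¬occurs⇒absent-before no-y)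

      chain-then-lower : ∀ k → f s ≡ 4 + k → f x ≡ 3 + k → ∀ y₀ → x < y₀ → y₀ < L → f y₀ ≡ 2 + k → ⊥
      chain-then-lower k fs fx y₀ x<y₀ y₀<L fy₀ with first-occurrence (2 + k) x y₀ x<y₀ fy₀
      ... | y , x<y , y≤y₀ , fy , no-2-before-y with occurs-before? (3 + k) x
      ... | yes (p , p<x , fp) with last-occurrence (3 + k) x p p<x fp
      ... | x′ , _ , x′<x , fx′ , no-3 =
        two-neighbours-between (3 + k) x′ x x′<x x<L fx′ fx no-3 λ p₁ p₂ x′<p₁ p₁<p₂ p₂<x a₁ a₂ →
          triple p₁ p₂ x′<p₁ p₁<p₂ p₂<x (lower p₁ x′<p₁ (<-trans p₁<p₂ p₂<x) a₁)
                 (lower p₂ (<-trans x′<p₁ p₁<p₂) p₂<x a₂)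
        where
        lower : ∀ p → x′ < p → p < x → AdjN (3 + k) (f p) → f p ≡ 2 + k
        lower p x′<p p<x a with adj-from-3+ k a
        ... | inj₁ e = e
        ... | inj₂ e = ⊥-elim (no-self-between x′ fx fs no-3 p x′<p p<x e)
        triple : ∀ p₁ p₂ → x′ < p₁ → p₁ < p₂ → p₂ < x → f p₁ ≡ 2 + k → f p₂ ≡ 2 + k → ⊥
        triple p₁ p₂ x′<p₁ p₁<p₂ p₂<x fp₁ fp₂ with last-occurrence (2 + k) x p₂ p₂<x fp₂
        ... | a₂ , p₂≤a₂ , a₂<x , fa₂ , no-2-after-a₂
          with last-occurrence (2 + k) a₂ p₁ (<-≤-trans p₁<p₂ p₂≤a₂) fp₁
        ... | a₁ , p₁≤a₁ , a₁<a₂ , fa₁ , no-2-after-a₁ =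
          consecutive-triple-needs-upper k a₁ a₂ y x a₁<a₂ (<-trans a₂<x x<y) y<L fa₁ fa₂ fy no-2-after-a₁
            (absent-across no-2-after-a₂ (λ e → 1+n≢n (trans (sym fx) e)) no-2-before-y)
            (absent-within no-3 (<⇒≤ x′<a₁) (<⇒≤ a₂<x))
            (only-at (absent-within no-3 (<⇒≤ (<-trans x′<a₁ a₁<a₂)) ≤-refl)
                     (parent-absent-after (3 + k) fx y (<⇒≤ y<L)))
          where
          y<L = ≤-<-trans y≤y₀ y₀<L
          x′<a₁ = <-≤-trans x′<p₁ p₁≤a₁
      chain-then-lower k fs fx y₀ x<y₀ y₀<L fy₀ | y , x<y , y≤y₀ , fy , no-2-before-y | no no-3
        with occurs-before? (2 + k) x
      ... | no no-2 = parent-not-minimal x-minimal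
        where
        x-minimal : ∀ p → p < x → Commute (f p) (f x)
        x-minimal p p<x c with subst (Conflict (f p)) fx c
        ... | inj₁ e = no-3 (p , p<x , e)
        ... | inj₂ a with adj-from-3+ k (adj-sym a)
        ... | inj₁ e = no-2 (p , p<x , e)
        ... | inj₂ e = no-self-before fx fs (¬occurs⇒absent-before no-3) p p<x e
      ... | yes (p , p<x , fp) with last-occurrence (2 + k) x p p<x fp
      ... | a , _ , a<x , fa , no-2-after-a = no-initial-peak k a x y record
        { z₁<m = a<x
        ; m<z₂ = x<y
        ; z₂<L = y<L
        ; f-z₁ = fa
        ; f-z₂ = fy
        ; f-m = fx
        ; no-lower-between = absent-across no-2-after-a (λ e → 1+n≢n (trans (sym fx) e)) no-2-before-y
        ; upper-only-at-m = only-at (absent-before⇒absent (¬occurs⇒absent-before no-3))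
                                    (parent-absent-after (3 + k) fx y (<⇒≤ y<L))
        ; no-upper-before = λ r r<a → ¬occurs⇒absent-before no-3 r (<-trans r<a a<x)
        ; no-next-before = no-self-before fx fs (¬occurs⇒absent-before no-3)
        }
        where y<L = ≤-<-trans y≤y₀ y₀<L

      via-parent : HigherTop s
      via-parent with anyUpTo? (λ y → (x <? y) ×-dec ¬? (y ≟ s) ×-dec conflict? (f y) (f x)) L
      ... | no none = ⊥-elim (no-noncommuting-suffix x s x<s s<L adj-xs maximal
                                λ p x<p p<L p≢s c → none (p , p<L , x<p , p≢s , c))
      ... | yes (y , y<L , x<y , y≢s , inj₁ e) = ⊥-elim (parent-absent-after (f x) refl L ≤-refl y x<y y<L e)
      ... | yes (y , y<L , x<y , y≢s , inj₂ a) with f y ≟ f s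
      ... | yes e = ⊥-elim (self-only-at-s x y self-absent-after-x x<y y≢s y<L e)
      ... | no fy≢fs = by-label (f s) refl parent
        where
        adj-x-y : ∀ {ℓ} → f x ≡ ℓ → AdjN ℓ (f y)
        adj-x-y fx = subst (λ z → AdjN z (f y)) fx (adj-sym a)
        not-s : ∀ {ℓ} → f s ≡ ℓ → f y ≢ ℓ
        not-s fs e = fy≢fs (trans e (sym fs))
        by-label : ∀ ℓ → f s ≡ ℓ → Parent ℓ (f x) → HigherTop s
        by-label 1 fs fx with adj-from-2 (adj-x-y fx)
        ... | inj₁ e = ⊥-elim (s₂-then-s₁ fs fx y x<y y<L e)
        ... | inj₂ (inj₁ e) = ⊥-elim (not-s fs e)
        ... | inj₂ (inj₂ e) = s₂-then-s₄ fs fx y x<y y<L e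
        by-label 2 fs fx = ⊥-elim (not-s fs (adj-from-0 (adj-x-y fx)))
        by-label 3 fs fx with adj-from-2-leaf (adj-x-y fx)
        ... | inj₁ leaf = ⊥-elim (s₄-then-leaf fs fx y x<y y<L leaf)
        ... | inj₂ e = ⊥-elim (not-s fs e)
        by-label (suc (suc (suc (suc k)))) fs fx with adj-from-3+ k (adj-x-y fx)
        ... | inj₁ e = ⊥-elim (chain-then-lower k fs fx y x<y y<L e)
        ... | inj₂ e = ⊥-elim (not-s fs e)

    from-parent : (∀ q → q < s → ¬ ChildBelow q) → HigherTop s
    from-parent no-child with last-conflict-before s nonminimal
    ... | x , x<s , cx , x-last = via-x cx
      where
      self-absent-after-x : Absent f (f s) x s
      self-absent-after-x = commute-after⇒self-absent x x-last
      via-x : Conflict (f x) (f s) → HigherTop s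
      via-x (inj₁ e) = ⊥-elim (two-neighbours-between (f s) x s x<s s<L e refl self-absent-after-x
                         λ p₁ _ x<p₁ p₁<p₂ p₂<s a₁ _ → x-last p₁ x<p₁ (<-trans p₁<p₂ p₂<s) (inj₂ (adj-sym a₁)))
      via-x (inj₂ a) with adj⇒child⊎parent (f s) (f x) a
      ... | inj₁ child = ⊥-elim (no-child x x<s (child , self-absent-after-x))
      ... | inj₂ parent = FromParent.via-parent no-child x x<s parent x-last

    higher-top : HigherTop s
    higher-top with anyUpTo? child-below? s
    ... | yes (q , q<s , c) = from-child q q<s c
    ... | no none = from-parent λ q q<s c → none (q , q<s , c)

  no-adjacent-pair : ∀ n → 3 ≤ n → (∀ p → p < L → f p < n) → ∀ i j → i < j → j < L → ¬ AdjN (f i) (f j)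
  no-adjacent-pair n 3≤n labels<n i j i<j j<L a
    with climb (λ _ → yes tt) n (λ _ _ _ _ → inj₁ tt) j j<L tt (i , i<j , inj₂ a)
               (λ p _ p<L e → <-irrefl e (labels<n p p<L))
  ... | s , top , _ = no-top-of-rank n s top (m≤n+m n _)
    where
    no-top-of-rank : ∀ k s → Top s → n ≤ rank (f s) + k → ⊥
    no-top-of-rank zero s (s<L , _) n≤rank+0 =
      <⇒≱ (rank< n (f s) 3≤n (labels<n s s<L)) (subst (n ≤_) (+-identityʳ _) n≤rank+0)
    no-top-of-rank (suc k) s (s<L , maximal , nonminimal) n≤rank+1+k
      with AtTop.higher-top s s<L maximal nonminimal
    ... | s′ , top′ , rank-s<rank-s′ =
      no-top-of-rank k s′ top′
        (≤-trans n≤rank+1+k (≤-trans (≤-reflexive (+-suc _ k)) (+-monoˡ-≤ k rank-s<rank-s′)))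

-- Letters of a word as labels (0 past the end)

label : ∀ {n} → Word n → ℕ → ℕ
label [] p = 0
label (x ∷ xs) zero = toℕ x
label (x ∷ xs) (suc p) = label xs p

module _ {n : ℕ} where

  label<n : ∀ (xs : Word n) p → p < length xs → label xs p < n
  label<n (x ∷ xs) zero _ = toℕ<n x
  label<n (x ∷ xs) (suc p) (s≤s p<) = label<n xs p p<

  label-++ˡ : ∀ (A ys : Word n) q → q < length A → label (A ++ ys) q ≡ label A q
  label-++ˡ (x ∷ A) ys zero _ = refl
  label-++ˡ (x ∷ A) ys (suc q) (s≤s q<) = label-++ˡ A ys q q<

  label-++ʳ : ∀ (A ys : Word n) q → label (A ++ ys) (length A + q) ≡ label ys q
  label-++ʳ [] ys q = refl
  label-++ʳ (x ∷ A) ys q = label-++ʳ A ys q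

  ∈⇒label : ∀ {t : Fin n} (xs : Word n) → t ∈ xs → ∃ λ q → q < length xs × label xs q ≡ toℕ t
  ∈⇒label (x ∷ xs) (here refl) = 0 , s≤s z≤n , refl
  ∈⇒label (x ∷ xs) (there t∈xs) with ∈⇒label xs t∈xs
  ... | q , q< , e = suc q , s≤s q< , e

  split-at : ∀ (v : Word n) i → i < length v →
             Σ (Word n) λ A → Σ (Fin n) λ a → Σ (Word n) λ R → v ≡ A ++ a ∷ R × length A ≡ i
  split-at (x ∷ v) zero _ = [] , x , v , refl , refl
  split-at (x ∷ v) (suc i) (s≤s i<) with split-at v i i<
  ... | A , a , R , v≡ , |A|≡i = x ∷ A , a , R , cong (x ∷_) v≡ , cong suc |A|≡i

-- Rewriting with the commutation relations

module _ {n : ℕ} where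

  ≈-∷ : ∀ (c : Fin n) {u v : Word n} → u ≈ v → c ∷ u ≈ c ∷ v
  ≈-∷ c {u} {v} u≈v = subst₂ _≈_ (++-identityʳ (c ∷ u)) (++-identityʳ (c ∷ v)) (≈-cong (c ∷ []) [] u≈v)

  ≈-++ˡ : ∀ (A : Word n) {u v : Word n} → u ≈ v → A ++ u ≈ A ++ v
  ≈-++ˡ [] u≈v = u≈v
  ≈-++ˡ (c ∷ A) u≈v = ≈-∷ c (≈-++ˡ A u≈v)

  CommutesWith : Fin n → Word n → Set
  CommutesWith a B = ∀ t → t ∈ B → Commute2 a t

  commutes-with-++ : ∀ {a} (X Y : Word n) → CommutesWith a X → CommutesWith a Y → CommutesWith a (X ++ Y)
  commutes-with-++ X Y cx cy t t∈X++Y with ∈-++⁻ X t∈X++Y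
  ... | inj₁ t∈X = cx t t∈X
  ... | inj₂ t∈Y = cy t t∈Y

  commutes-with-labels : ∀ a (B : Word n) → (∀ q → q < length B → Commute (label B q) (toℕ a)) → CommutesWith a B
  commutes-with-labels a B commute t t∈B with ∈⇒label B t∈B
  ... | q , q< , e = (λ a≡t → c (inj₁ (cong toℕ (sym a≡t)))) , (λ a-t → c (inj₂ (adj-sym a-t)))
    where c = subst (λ z → Commute z (toℕ a)) e (commute q q<)

  commute-past : ∀ a (B R : Word n) → CommutesWith a B → a ∷ B ++ R ≈ B ++ a ∷ R
  commute-past a [] R _ = ≈-refl
  commute-past a (b ∷ B) R commute =
    ≈-trans (≈-cong [] (B ++ R) (rel-2 a b (commute b (here refl))))
            (≈-∷ b (commute-past a B R (λ t t∈B → commute t (there t∈B))))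

  reduced-≈ : ∀ {u v : Word n} → Reduced v → u ≈ v → length u ≡ length v → Reduced u
  reduced-≈ {u} reduced-v u≈v |u|≡|v| u′ u′≈u =
    subst (_≤ length u′) (sym |u|≡|v|) (reduced-v u′ (≈-trans u′≈u u≈v))

  reduced-prefix : ∀ (X Y : Word n) → Reduced (X ++ Y) → Reduced X
  reduced-prefix X Y reduced u u≈X =
    +-cancelʳ-≤ (length Y) (length X) (length u)
      (subst₂ _≤_ (length-++ X) (length-++ u) (reduced (u ++ Y) (≈-cong [] Y u≈X)))

  reduced-suffix : ∀ (X Y : Word n) → Reduced (X ++ Y) → Reduced Y
  reduced-suffix X Y reduced u u≈Y =
    +-cancelˡ-≤ (length X) (length Y) (length u)
      (subst₂ _≤_ (length-++ X) (length-++ X)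
        (reduced (X ++ u) (subst₂ _≈_ (cong (X ++_) (++-identityʳ u)) (cong (X ++_) (++-identityʳ Y))
                                      (≈-cong X [] u≈Y))))

  has-length : ∀ {v w : Word n} → v ≈ w → Reduced v → HasLength w (length v)
  has-length v≈w reduced = (_ , v≈w , refl) , λ u u≈w → reduced u (≈-trans u≈w (≈-sym v≈w))

  ¬¬reduced-expression : ∀ k (w : Word n) → length w ≤ k → ¬ ¬ (Σ (Word n) λ v → v ≈ w × Reduced v)
  ¬¬reduced-expression zero [] _ none = none ([] , ≈-refl , λ _ _ → z≤n)
  ¬¬reduced-expression (suc k) w |w|≤1+k none = none (w , ≈-refl , reduced)
    where
    reduced : Reduced w
    reduced u u≈w with length w ≤? length u
    ... | yes |w|≤|u| = |w|≤|u|
    ... | no |w|≰|u| = ⊥-elim (¬¬reduced-expression k u (≤-pred (≤-trans (≰⇒> |w|≰|u|) |w|≤1+k))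
                                 λ { (v , v≈u , rv) → none (v , ≈-trans v≈u u≈w , rv) })

record TwoPositions {n : ℕ} (v : Word n) (i j : ℕ) : Set where
  constructor two-positions
  field
    before middle after : Word n
    a b : Fin n
    v≡ : v ≡ before ++ a ∷ middle ++ b ∷ after
    i≡ : i ≡ length before
    j≡ : j ≡ suc (length before + length middle)

module _ {n : ℕ} where

  label-at-length : ∀ (A : Word n) a R → label (A ++ a ∷ R) (length A) ≡ toℕ a
  label-at-length [] a R = refl
  label-at-length (x ∷ A) a R = label-at-length A a R

  label-after-length : ∀ (A : Word n) a R q → label (A ++ a ∷ R) (suc (length A + q)) ≡ label R q
  label-after-length [] a R q = refl
  label-after-length (x ∷ A) a R q = label-after-length A a R q

  split-twice : ∀ (v : Word n) i j → i < j → j < length v → TwoPositions v i j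
  split-twice v i j i<j j<|v| with split-at v j j<|v|
  ... | P , b , C , v≡P++bC , |P|≡j with split-at P i (subst (i <_) (sym |P|≡j) i<j)
  ... | A , a , B , P≡A++aB , |A|≡i =
    two-positions A B C a b (trans v≡P++bC (trans (cong (_++ b ∷ C) P≡A++aB) (++-assoc A (a ∷ B) (b ∷ C))))
      (sym |A|≡i) j≡
    where
    open ≡-Reasoning
    j≡ : j ≡ suc (length A + length B)
    j≡ = begin
      j                           ≡⟨ sym |P|≡j ⟩
      length P                    ≡⟨ cong length P≡A++aB ⟩
      length (A ++ a ∷ B)         ≡⟨ length-++ A ⟩
      length A + suc (length B)   ≡⟨ +-suc (length A) (length B) ⟩
      suc (length A + length B)   ∎

module TwoPositionLabels {n : ℕ} {v : Word n} {i j : ℕ} (d : TwoPositions v i j) where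
  open TwoPositions d

  label-a : label v i ≡ toℕ a
  label-a rewrite v≡ | i≡ = label-at-length before a (middle ++ b ∷ after)

  label-b : label v j ≡ toℕ b
  label-b rewrite v≡ | j≡ =
    trans (label-after-length before a (middle ++ b ∷ after) (length middle)) (label-at-length middle b after)

  label-before : ∀ q → q < length before → label v q ≡ label before q
  label-before q q< rewrite v≡ = label-++ˡ before (a ∷ middle ++ b ∷ after) q q<

  label-middle : ∀ q → q < length middle → label v (suc (i + q)) ≡ label middle q
  label-middle q q< rewrite v≡ | i≡ =
    trans (label-after-length before a (middle ++ b ∷ after) q) (label-++ˡ middle (b ∷ after) q q<)

  label-after : ∀ q → label v (suc (j + q)) ≡ label after q
  label-after q rewrite v≡ | j≡ =
    trans (cong (label (before ++ a ∷ middle ++ b ∷ after)) (reassociate (length before) (length middle) q))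
      (trans (label-after-length before a (middle ++ b ∷ after) (length middle + suc q))
             (label-++ʳ middle (b ∷ after) (suc q)))
    where
    reassociate : ∀ x y z → suc (suc (x + y) + z) ≡ suc (x + (y + suc z))
    reassociate = solve-∀

  length-v : length v ≡ suc (j + length after)
  length-v rewrite v≡ | j≡ =
    trans (length-++ before) (trans (cong (λ z → length before + suc z) (length-++ middle))
                                    (reassociate (length before) (length middle) (length after)))
    where
    reassociate : ∀ x y z → x + suc (y + suc z) ≡ suc (suc (x + y) + z)
    reassociate = solve-∀

  j≡i+middle : j ≡ suc (i + length middle)
  j≡i+middle = trans j≡ (cong (λ z → suc (z + length middle)) (sym i≡))

  LabelsWithin : ℕ → ℕ → Word n → Set
  LabelsWithin lo hi B = ∀ q → q < length B → Σ ℕ λ r → lo < r × r < hi × label v r ≡ label B q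

  commutes-with-within : ∀ c {lo hi} B → LabelsWithin lo hi B →
                         (∀ p → lo < p → p < hi → Commute (label v p) (toℕ c)) → CommutesWith c B
  commutes-with-within c B within commute = commutes-with-labels c B λ q q< →
    let r , lo<r , r<hi , e = within q q< in subst (λ z → Commute z (toℕ c)) e (commute r lo<r r<hi)

  commutes-with-before : ∀ c → (∀ p → p < i → Commute (label v p) (toℕ c)) → CommutesWith c before
  commutes-with-before c commute = commutes-with-labels c before λ q q< →
    subst (λ z → Commute z (toℕ c)) (label-before q q<) (commute q (subst (q <_) (sym i≡) q<))

  middle-within : LabelsWithin i j middle
  middle-within q q< =
    suc (i + q) , s≤s (m≤m+n i q) , subst (suc (i + q) <_) (sym j≡i+middle) (s≤s (+-monoʳ-< i q<)) ,
                       label-middle q q<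

  after-within : LabelsWithin j (length v) after
  after-within q q< =
    suc (j + q) , s≤s (m≤m+n j q) , subst (suc (j + q) <_) (sym length-v) (s≤s (+-monoʳ-< j q<)) ,
                      label-after q

  record MiddleSplit (p : ℕ) : Set where
    constructor middle-split
    field
      B₁ : Word n
      t : Fin n
      B₂ : Word n
      middle≡ : middle ≡ B₁ ++ t ∷ B₂
      label-t : label v p ≡ toℕ t
      B₁-within : LabelsWithin i p B₁
      B₂-within : LabelsWithin p j B₂

  split-middle : ∀ p → i < p → p < j → MiddleSplit p
  split-middle p i<p p<j with m≤n⇒∃[o]m+o≡n i<p
  ... | q , refl
    with split-at middle q (+-cancelˡ-< i q (length middle) (≤-pred (subst (suc (i + q) <_) j≡i+middle p<j)))
  ... | B₁ , t , B₂ , middle≡ , refl = middle-split B₁ t B₂ middle≡ label-t within₁ within₂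
    where
    |middle| : length middle ≡ length B₁ + suc (length B₂)
    |middle| = trans (cong length middle≡) (length-++ B₁)
    label-middle′ : ∀ r → r < length middle → label v (suc (i + r)) ≡ label (B₁ ++ t ∷ B₂) r
    label-middle′ r r< = trans (label-middle r r<) (cong (λ z → label z r) middle≡)
    label-t : label v (suc (i + length B₁)) ≡ toℕ t
    label-t = trans (label-middle′ (length B₁) (subst (length B₁ <_) (sym |middle|) (m<m+n (length B₁) (s≤s z≤n))))
                    (label-at-length B₁ t B₂)
    within₁ : LabelsWithin i (suc (i + length B₁)) B₁
    within₁ r r< = suc (i + r) , s≤s (m≤m+n i r) , s≤s (+-monoʳ-< i r<) ,
      trans (label-middle′ r (<-≤-trans r< (subst (length B₁ ≤_) (sym |middle|) (m≤m+n (length B₁) _))))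
            (label-++ˡ B₁ (t ∷ B₂) r r<)
    within₂ : LabelsWithin (suc (i + length B₁)) j B₂
    within₂ r r< = suc (i + suc (length B₁ + r)) , s≤s (+-monoʳ-< i (s≤s (m≤m+n (length B₁) r))) ,
      subst (suc (i + suc (length B₁ + r)) <_) (sym j≡i+middle) (s≤s (+-monoʳ-< i position<)) ,
      trans (label-middle′ (suc (length B₁ + r)) position<) (label-after-length B₁ t B₂ r)
      where
      position< : suc (length B₁ + r) < length middle
      position< = subst (suc (length B₁ + r) <_) (sym |middle|)
                    (subst (_< length B₁ + suc (length B₂)) (+-suc (length B₁) r) (+-monoʳ-< (length B₁) (s≤s r<)))

module Rearrangements {n : ℕ} {v : Word n} {i j : ℕ} (d : TwoPositions v i j) where
  open TwoPositions d

  to-front : CommutesWith a before → CommutesWith b (before ++ middle) → v ≈ a ∷ b ∷ (before ++ middle) ++ after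
  to-front a-before b-before-middle rewrite v≡ =
    ≈-trans (≈-sym (commute-past a before (middle ++ b ∷ after) a-before))
      (≈-∷ a (subst (_≈ b ∷ (before ++ middle) ++ after) (++-assoc before middle (b ∷ after))
                (≈-sym (commute-past b (before ++ middle) after b-before-middle))))

  to-back : CommutesWith a (middle ++ after) → CommutesWith b after → v ≈ (before ++ middle ++ after) ++ a ∷ b ∷ []
  to-back a-middle-after b-after rewrite v≡ =
    subst (before ++ a ∷ middle ++ b ∷ after ≈_) (sym (++-assoc before (middle ++ after) (a ∷ b ∷ [])))
      (≈-++ˡ before (≈-trans (≈-∷ a (≈-++ˡ middle b-last))
        (subst (λ z → a ∷ z ≈ (middle ++ after) ++ a ∷ b ∷ []) (++-assoc middle after (b ∷ []))
          (commute-past a (middle ++ after) (b ∷ []) a-middle-after))))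
    where
    b-last : b ∷ after ≈ after ++ b ∷ []
    b-last = subst (λ z → b ∷ z ≈ after ++ b ∷ []) (++-identityʳ after) (commute-past b after [] b-after)

  cancel : a ≡ b → CommutesWith a middle → v ≈ before ++ middle ++ after
  cancel refl a-middle rewrite v≡ =
    ≈-++ˡ before (≈-trans (commute-past a middle (a ∷ after) a-middle) (≈-++ˡ middle (≈-cong [] after (rel-sq a))))

  braid : ∀ {B₁ t B₂} → a ≡ b → middle ≡ B₁ ++ t ∷ B₂ → CommutesWith a B₁ → CommutesWith a B₂ →
          v ≈ (before ++ B₁) ++ a ∷ t ∷ a ∷ B₂ ++ after
  braid {B₁} {t} {B₂} refl refl a-B₁ a-B₂ rewrite v≡ =
    subst (before ++ a ∷ (B₁ ++ t ∷ B₂) ++ a ∷ after ≈_) (sym (++-assoc before B₁ (a ∷ t ∷ a ∷ B₂ ++ after)))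
      (≈-++ˡ before (subst (λ z → a ∷ z ≈ B₁ ++ a ∷ t ∷ a ∷ B₂ ++ after) (sym (++-assoc B₁ (t ∷ B₂) (a ∷ after)))
        (≈-trans (commute-past a B₁ (t ∷ B₂ ++ a ∷ after) a-B₁)
          (≈-++ˡ B₁ (≈-∷ a (≈-∷ t (≈-sym (commute-past a B₂ after a-B₂))))))))

  length-segments : length v ≡ length before + length middle + length after + 2
  length-segments rewrite v≡ | length-++ before {a ∷ middle ++ b ∷ after} | length-++ middle {b ∷ after} =
    shuffle (length before) (length middle) (length after)
    where
    shuffle : ∀ x y z → x + suc (y + suc z) ≡ x + y + z + 2
    shuffle = solve-∀

  length-to-front : length (a ∷ b ∷ (before ++ middle) ++ after) ≡ length v
  length-to-front rewrite length-segments | length-++ (before ++ middle) {after} | length-++ before {middle} =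
    shuffle (length before) (length middle) (length after)
    where
    shuffle : ∀ x y z → suc (suc (x + y + z)) ≡ x + y + z + 2
    shuffle = solve-∀

  length-to-back : length ((before ++ middle ++ after) ++ a ∷ b ∷ []) ≡ length v
  length-to-back rewrite length-segments | length-++ (before ++ middle ++ after) {a ∷ b ∷ []}
                       | length-++ before {middle ++ after} | length-++ middle {after} =
    shuffle (length before) (length middle) (length after)
    where
    shuffle : ∀ x y z → x + (y + z) + 2 ≡ x + y + z + 2
    shuffle = solve-∀

  length-cancel : length (before ++ middle ++ after) < length v
  length-cancel rewrite length-segments | length-++ before {middle ++ after} | length-++ middle {after} =
    subst (_< length before + length middle + length after + 2)
          (+-assoc (length before) (length middle) (length after))
      (m<m+n _ (s≤s z≤n))

  length-braid : ∀ {B₁ t B₂} → middle ≡ B₁ ++ t ∷ B₂ →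
                 length v ≡ length ((before ++ B₁) ++ a ∷ t ∷ a ∷ B₂ ++ after)
                 × length v ≡ length (before ++ B₁) + 3 + length (B₂ ++ after)
  length-braid {B₁} {t} {B₂} middle≡ rewrite length-segments | middle≡ | length-++ B₁ {t ∷ B₂}
    | length-++ (before ++ B₁) {a ∷ t ∷ a ∷ B₂ ++ after} | length-++ before {B₁} | length-++ B₂ {after} =
    shuffle₁ (length before) (length B₁) (length B₂) (length after) ,
    shuffle₂ (length before) (length B₁) (length B₂) (length after)
    where
    shuffle₁ : ∀ x y z u → x + (y + suc z) + u + 2 ≡ x + y + suc (suc (suc (z + u)))
    shuffle₁ = solve-∀
    shuffle₂ : ∀ x y z u → x + (y + suc z) + u + 2 ≡ x + y + 3 + (z + u)
    shuffle₂ = solve-∀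

module BadFullyCommutative {n : ℕ} {w : Word n} (bad : Bad w) (fc : FullyCommutative w)
                           {v : Word n} (v≈w : v ≈ w) (reduced : Reduced v) where

  module Split (i j : ℕ) (i<j : i < j) (j<|v| : j < length v) where
    d = split-twice v i j i<j j<|v|
    open TwoPositions d public
    open TwoPositionLabels d public
    open Rearrangements d public

  no-noncommuting-prefix : ∀ i j → i < j → j < length v → AdjN (label v i) (label v j) →
                           (∀ p → p < i → Commute (label v p) (label v i)) →
                           (∀ p → p < j → p ≢ i → Commute (label v p) (label v j)) → ⊥
  no-noncommuting-prefix i j i<j j<|v| adj i-minimal j-only-above-i =
    proj₁ (proj₂ bad _ (≈-trans (≈-sym v≈v′) v≈w) (reduced-≈ reduced (≈-sym v≈v′) length-to-front))
      (a , b , _ , refl , subst₂ AdjN label-a label-b adj)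
    where
    open Split i j i<j j<|v|
    v≈v′ : v ≈ a ∷ b ∷ (before ++ middle) ++ after
    v≈v′ = to-front
      (commutes-with-before a λ p p<i → subst (Commute (label v p)) label-a (i-minimal p p<i))
      (commutes-with-++ before middle
        (commutes-with-before b λ p p<i →
          subst (Commute (label v p)) label-b (j-only-above-i p (<-trans p<i i<j) (<⇒≢ p<i)))
        (commutes-with-within b middle middle-within λ p i<p p<j →
          subst (Commute (label v p)) label-b (j-only-above-i p p<j (≢-sym (<⇒≢ i<p)))))

  no-noncommuting-suffix : ∀ i j → i < j → j < length v → AdjN (label v i) (label v j) →
                           (∀ p → j < p → p < length v → Commute (label v p) (label v j)) →
                           (∀ p → i < p → p < length v → p ≢ j → Commute (label v p) (label v i)) → ⊥
  no-noncommuting-suffix i j i<j j<|v| adj j-maximal i-only-below-j =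
    proj₂ (proj₂ bad _ (≈-trans (≈-sym v≈v′) v≈w) (reduced-≈ reduced (≈-sym v≈v′) length-to-back))
      (a , b , _ , refl , subst₂ AdjN label-a label-b adj)
    where
    open Split i j i<j j<|v|
    v≈v′ : v ≈ (before ++ middle ++ after) ++ a ∷ b ∷ []
    v≈v′ = to-back
      (commutes-with-++ middle after
        (commutes-with-within a middle middle-within λ p i<p p<j →
          subst (Commute (label v p)) label-a (i-only-below-j p i<p (<-trans p<j j<|v|) (<⇒≢ p<j)))
        (commutes-with-within a after after-within λ p j<p p<|v| →
          subst (Commute (label v p)) label-a (i-only-below-j p (<-trans i<j j<p) p<|v| (≢-sym (<⇒≢ j<p)))))
      (commutes-with-within b after after-within λ p j<p p<|v| →
        subst (Commute (label v p)) label-b (j-maximal p j<p p<|v|))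

  module EqualLabels (ℓ i k : ℕ) (i<k : i < k) (k<|v| : k < length v) (fi : label v i ≡ ℓ) (fk : label v k ≡ ℓ) where
    open Split i k i<k k<|v| public

    a≡ℓ : toℕ a ≡ ℓ
    a≡ℓ = trans (sym label-a) fi

    a≡b : a ≡ b
    a≡b = toℕ-injective (trans a≡ℓ (trans (sym fk) label-b))

  -- With no neighbour of ℓ in between the two copies cancel; with exactly one, t say, the word can be
  -- rearranged to contain ℓ t ℓ, against full commutativity.
  two-neighbours-between : ∀ ℓ i k → i < k → k < length v → label v i ≡ ℓ → label v k ≡ ℓ →
                           Absent (label v) ℓ i k → ¬ NoTwoNeighbours (label v) ℓ i k
  two-neighbours-between ℓ i k i<k k<|v| fi fk no-ℓ no-two
    with anyUpTo? (λ p → (i <? p) ×-dec adj? ℓ (label v p)) k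
  ... | no none =
    <⇒≱ length-cancel (reduced _ (≈-sym (cancel a≡b (commutes-with-within a middle middle-within a-commutes))))
    where
    open EqualLabels ℓ i k i<k k<|v| fi fk
    a-commutes : ∀ p → i < p → p < k → Commute (label v p) (toℕ a)
    a-commutes p i<p p<k (inj₁ e) = no-ℓ p i<p p<k (trans e a≡ℓ)
    a-commutes p i<p p<k (inj₂ adj) = none (p , p<k , i<p , subst (λ z → AdjN z (label v p)) a≡ℓ (adj-sym adj))
  ... | yes (p , p<k , i<p , adj-p) =
    fc (before ++ B₁ , B₂ ++ after , a , t , length v , length (before ++ B₁) , length (B₂ ++ after) ,
        subst₂ AdjN (sym a≡ℓ) label-t adj-p , ≈-trans (≈-sym v≈w) v≈v′ ,
        has-length v≈w reduced , has-length ≈-refl reduced₁ , has-length ≈-refl reduced₂ ,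
        proj₂ (length-braid middle≡))
    where
    open EqualLabels ℓ i k i<k k<|v| fi fk
    open MiddleSplit (split-middle p i<p p<k)
    a-commutes : ∀ r → i < r → r < k → r ≢ p → Commute (label v r) (toℕ a)
    a-commutes r i<r r<k r≢p (inj₁ e) = no-ℓ r i<r r<k (trans e a≡ℓ)
    a-commutes r i<r r<k r≢p (inj₂ adj) with <-cmp r p
    ... | tri< r<p _ _ = no-two r p i<r r<p p<k (subst (λ z → AdjN z (label v r)) a≡ℓ (adj-sym adj)) adj-p
    ... | tri≈ _ r≡p _ = r≢p r≡p
    ... | tri> _ _ p<r = no-two p r i<p p<r r<k adj-p (subst (λ z → AdjN z (label v r)) a≡ℓ (adj-sym adj))
    v≈v′ : v ≈ (before ++ B₁) ++ a ∷ t ∷ a ∷ B₂ ++ after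
    v≈v′ = braid a≡b middle≡
      (commutes-with-within a B₁ B₁-within λ r i<r r<p → a-commutes r i<r (<-trans r<p p<k) (<⇒≢ r<p))
      (commutes-with-within a B₂ B₂-within λ r p<r r<k → a-commutes r (<-trans i<p p<r) r<k (≢-sym (<⇒≢ p<r)))
    reduced′ : Reduced ((before ++ B₁) ++ a ∷ t ∷ a ∷ B₂ ++ after)
    reduced′ = reduced-≈ reduced (≈-sym v≈v′) (sym (proj₁ (length-braid middle≡)))
    reduced₁ : Reduced (before ++ B₁)
    reduced₁ = reduced-prefix (before ++ B₁) _ reduced′
    reduced₂ : Reduced (B₂ ++ after)
    reduced₂ = reduced-suffix (a ∷ t ∷ a ∷ []) _ (reduced-suffix (before ++ B₁) _ reduced′)

  heap-conditions : HeapConditions (length v) (label v)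
  heap-conditions = record
    { two-neighbours-between = two-neighbours-between
    ; no-noncommuting-prefix = no-noncommuting-prefix
    ; no-noncommuting-suffix = no-noncommuting-suffix
    }

no-adjacent⇒pairwise-commuting : ∀ {n} (v : Word n) →
  (∀ i j → i < j → j < length v → ¬ AdjN (label v i) (label v j)) → PairwiseCommuting v
no-adjacent⇒pairwise-commuting [] _ = pc-[]
no-adjacent⇒pairwise-commuting (s ∷ v) no-adjacent =
  pc-∷ s-commutes
    (no-adjacent⇒pairwise-commuting v λ i j i<j j<|v| → no-adjacent (suc i) (suc j) (s≤s i<j) (s≤s j<|v|))
  where
  s-commutes : ∀ {t} → t ∈ v → ¬ Adj s t
  s-commutes t∈v adj with ∈⇒label v t∈v
  ... | q , q< , e = no-adjacent 0 (suc q) (s≤s z≤n) (s≤s q<) (subst (AdjN (toℕ s)) (sym e) adj)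

corollary2p37 : (n : ℕ) → 4 ≤ n → (w : Word n) → Bad w → ¬ FullyCommutative w
corollary2p37 n 4≤n w bad fc = ¬¬reduced-expression (length w) w ≤-refl λ (v , v≈w , reduced) →
  let open BadFullyCommutative bad fc v≈w reduced
      no-adjacent = HeapCore.no-adjacent-pair heap-conditions n (≤-trans (s≤s (s≤s (s≤s z≤n))) 4≤n) (label<n v)
  in proj₁ bad (v , v≈w , no-adjacent⇒pairwise-commuting v no-adjacent)
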